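{- Let $v$ be a signed-simplicial vertex of a signed graph $G$ and let $F=G\setminus\{v\}$ (the induced subgraph on $V_G\setminus\{v\}$). Then: (1) if $v$ has an adjacent vertex $w$, then $G/(v,w)=F$; (2) if $v$ has a loop or an adjacent vertex, then $\operatorname{rank}(G)=\operatorname{rank}(F)+1$; (3) if $d$ denotes the degree of $v$ (the number of positive and negative edges incident to $v$, plus one if $v$ has a loop), then $\chi(G,t)=(t-d)\chi(F,t)$; (4) $G$ is balanced chordal if and only if $F$ is balanced chordal.
   Context: A signed graph $G=(G^+,G^-,L_G)$ consists of simple graphs $G^+=(V_G,E_G^+)$, $G^-=(V_G,E_G^-)$ on a common finite vertex set and a loop set $L_G\subseteq V_G$; $u,v$ are adjacent if joined by a positive or negative edge. A vertex $v$ is signed simplicial if: (a) whenever $\{u_1,v\},\{u_2,v\}\in E_G^+$ or $\{u_1,v\},\{u_2,v\}\in E_G^-$ (with $u_1\ne u_2$), then $\{u_1,u_2\}\in E_G^+$; (b) whenever $\{u_1,v\}\in E_G^+$ and $\{u_2,v\}\in E_G^-$ (with $u_1\ne u_2$), then $\{u_1,u_2\}\in E_G^-$; (c) if $\{u,v\}\in E_G^+\cup E_G^-$ and $v\in L_G$, or if $\{u,v\}\in E_G^+\cap E_G^-$, then $u\in L_G$. Contraction $G/(v,w)$ of a positive edge $\{v,w\}$: vertex set $V_G\setminus\{v\}$; positive edges those not containing $v$ plus $\{u,w\}$ for $u\ne w$ with $\{u,v\}\in E_G^+$; negative edges those not containing $v$ plus $\{u,w\}$ for $u\ne w$ with $\{u,v\}\in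 E_G^-$; loops $L_G\setminus\{v\}$ plus $w$ if $v\in L_G$ or $\{v,w\}\in E_G^-$. For a negative edge $\{v,w\}$ the same with the roles of $E_G^+$ and $E_G^-$ swapped in the new edges $\{u,w\}$ and with $w$ made a loop if $v\in L_G$ or $\{v,w\}\in E_G^+$. Cycles: a cycle of length $k\ge3$ is a sequence of distinct vertices $v_1,\dots,v_k$ with edges $\{v_1,v_2\},\dots,\{v_k,v_1\}$, each positive or negative; a $1$-cycle is a vertex with its loop; a $2$-cycle is a pair of vertices joined by both a positive and a negative edge. A cycle is balanced if it has an even number of negative edges (loops count as negative, so $1$- and $2$-cycles are unbalanced). $G$ is balanced if all its cycles are balanced. $\operatorname{rank}(G)=|V_G|-b(G)$ where $b(G)$ is the number of balanced connected components of $G$. With $\Lambda_k=\{0,\pm1,\dots,\pm k\}$, a proper $k$-coloring is $\gamma:V_G\to\Lambda_k$ with $\gamma(u)\ne\gamma(v)$ for positive edges, $\gamma(u)\ne-\gamma(v)$ for negative edges, $\gamma(v)\ne0$ for loops; $\chi(G,t)$ is the polynomial with $\chi(G,2k+1)=$ number of proper $k$-colorings for all $k\ge1$. A balanced chord of a balanced cycle is an edge not in the cycle connecting two of its vertices and separating it into two balanced cycles; $G$ is balanced chordal if every balanced cycle of length at least four has a balanced chord. -}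

module Defs where

open import Data.Bool using (Bool; true; false; _∧_; _∨_; not; if_then_else_)
open import Data.Nat as ℕ using (ℕ; zero; suc; _+_; _*_; _∸_; _%_)
open import Data.Integer as ℤ using (ℤ; +_; -_)
open import Data.Fin as Fin using (Fin; toℕ; punchIn; fromℕ<)
open import Data.Fin.Properties using (all?)
open import Data.Nat.DivMod using (m%n<n)
open import Data.List using (List; []; _∷_; length; map; concatMap; filter; filterᵇ; allFin; upTo)
open import Data.List.Membership.Propositional using (_∈_)
open import Data.List.Relation.Unary.Unique.Propositional using (Unique)
open import Data.Vec as Vec using (Vec; lookup)
open import Data.Product using (Σ; ∃; ∃-syntax; _×_; _,_)
open import Data.Sum using (_⊎_)
open import Function using (_∘_; _⇔_)
open import Function.Definitions using (Injective)
open import Relation.Binary.PropositionalEquality using (_≡_; _≢_)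
open import Relation.Binary.Construct.Closure.ReflexiveTransitive using (Star)
open import Relation.Nullary using (Dec; does; ¬_)
open import Relation.Nullary.Decidable using (_×-dec_; _→-dec_; ¬?)
open import Relation.Unary using (Decidable)

-- Signed graphs on the vertex set Fin n.
-- pos / neg : the (Boolean) adjacency relations of G⁺ and G⁻; loop : L_G.

record SG (n : ℕ) : Set where
  field
    pos  : Fin n → Fin n → Bool
    neg  : Fin n → Fin n → Bool
    loop : Fin n → Bool
open SG public

record Simple {n : ℕ} (G : SG n) : Set where
  field
    pos-sym : ∀ i j → pos G i j ≡ pos G j i
    neg-sym : ∀ i j → neg G i j ≡ neg G j i
    pos-irr : ∀ i → pos G i i ≡ false
    neg-irr : ∀ i → neg G i i ≡ false

_≈G_ : ∀ {n} → SG n → SG n → Set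
G ≈G H = (∀ i j → pos G i j ≡ pos H i j) × (∀ i j → neg G i j ≡ neg H i j)
         × (∀ i → loop G i ≡ loop H i)

data Sign : Set where
  ⊕ ⊖ : Sign

isNeg : Sign → Bool
isNeg ⊕ = false
isNeg ⊖ = true

edgeB : ∀ {n} → SG n → Sign → Fin n → Fin n → Bool
edgeB G ⊕ = pos G
edgeB G ⊖ = neg G

HasEdge : ∀ {n} → SG n → Sign → Fin n → Fin n → Set
HasEdge G s u v = edgeB G s u v ≡ true

Adj : ∀ {n} → SG n → Fin n → Fin n → Set
Adj G u v = pos G u v ≡ true ⊎ neg G u v ≡ true

record SignedSimplicial {n : ℕ} (G : SG n) (v : Fin n) : Set where
  field
    condA : ∀ u₁ u₂ → u₁ ≢ u₂ →
            ((pos G u₁ v ≡ true × pos G u₂ v ≡ true) ⊎ (neg G u₁ v ≡ true × neg G u₂ v ≡ true)) →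
            pos G u₁ u₂ ≡ true
    condB : ∀ u₁ u₂ → u₁ ≢ u₂ → pos G u₁ v ≡ true → neg G u₂ v ≡ true →
            neg G u₁ u₂ ≡ true
    condC : ∀ u → ((Adj G u v × loop G v ≡ true) ⊎ (pos G u v ≡ true × neg G u v ≡ true)) →
            loop G u ≡ true

-- Deletion of a vertex: the induced subgraph on V ∖ {v}, whose vertices are
-- identified with Fin n via punchIn v.

delete : ∀ {n} → SG (suc n) → Fin (suc n) → SG n
pos  (delete G v) a b = pos G (punchIn v a) (punchIn v b)
neg  (delete G v) a b = neg G (punchIn v a) (punchIn v b)
loop (delete G v) a   = loop G (punchIn v a)

-- Contraction G/(v,w) of an edge {v,w} of sign s; vertex set V ∖ {v}
-- (identified with Fin n via punchIn v).
_==_ : ∀ {n} → Fin n → Fin n → Bool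
x == y = does (x Fin.≟ y)

flip : Sign → Sign
flip ⊕ = ⊖
flip ⊖ = ⊕

-- new edges of sign t: those not containing v, plus {u,w} (u ≠ w) when {u,v}
-- has sign t (s = ⊕) resp. sign (flip t) (s = ⊖).
private
  newEdge : ∀ {n} → SG (suc n) → Sign → Sign → Fin (suc n) → Fin (suc n) →
            Fin (suc n) → Fin (suc n) → Bool
  newEdge G s t v w x y =
    edgeB G t x y
    ∨ ((y == w) ∧ edgeB G (sgnOf s t) x v ∧ not (x == w))
    ∨ ((x == w) ∧ edgeB G (sgnOf s t) y v ∧ not (y == w))
    where
      sgnOf : Sign → Sign → Sign
      sgnOf ⊕ t = t
      sgnOf ⊖ t = flip t

contract : ∀ {n} → SG (suc n) → Sign → Fin (suc n) → Fin (suc n) → SG n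
pos  (contract G s v w) a b = newEdge G s ⊕ v w (punchIn v a) (punchIn v b)
neg  (contract G s v w) a b = newEdge G s ⊖ v w (punchIn v a) (punchIn v b)
loop (contract G s v w) a   =
  loop G (punchIn v a) ∨ ((punchIn v a == w) ∧ (loop G v ∨ edgeB G (flip s) v w))

nextPos : ∀ {k} .{{_ : ℕ.NonZero k}} → Fin k → Fin k
nextPos {k} i = fromℕ< (m%n<n (suc (toℕ i)) k)

-- a cycle of length k = 3 + m ≥ 3: distinct vertices vtx 0, …, vtx (k-1),
-- with an edge of sign sgn i between vtx i and vtx (i+1 mod k).
record Cycle {n : ℕ} (G : SG n) : Set where
  field
    m    : ℕ
    vtx  : Fin (3 + m) → Fin n
    inj  : Injective _≡_ _≡_ vtx
    sgn  : Fin (3 + m) → Sign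
    edge : ∀ i → HasEdge G (sgn i) (vtx i) (vtx (nextPos i))

  len : ℕ
  len = 3 + m

  negsIn : ℕ → ℕ → ℕ
  negsIn lo hi = length (filterᵇ (λ p → isNeg (sgn p) ∧ (lo ℕ.≤ᵇ toℕ p) ∧ (toℕ p ℕ.<ᵇ hi)) (allFin len))

  negs : ℕ
  negs = length (filterᵇ (λ p → isNeg (sgn p)) (allFin len))
open Cycle public

EvenN : ℕ → Set
EvenN k = k % 2 ≡ 0

-- all cycles: 1-cycles (loops), 2-cycles (a positive and a negative edge
-- between two vertices) and cycles of length ≥ 3.
data AnyCycle {n : ℕ} (G : SG n) : Set where
  cyc1 : (u : Fin n) → loop G u ≡ true → AnyCycle G
  cyc2 : (u v : Fin n) → pos G u v ≡ true → neg G u v ≡ true → AnyCycle G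
  cycL : Cycle G → AnyCycle G

-- loops count as negative, so 1- and 2-cycles are unbalanced
BalancedCycle : ∀ {n} {G : SG n} → AnyCycle G → Set
BalancedCycle (cyc1 _ _)     = Data.Empty.⊥ where import Data.Empty
BalancedCycle (cyc2 _ _ _ _) = Data.Empty.⊥ where import Data.Empty
BalancedCycle (cycL C)       = EvenN (negs C)

OnCycle : ∀ {n} {G : SG n} → AnyCycle G → Fin n → Set
OnCycle (cyc1 u _)     x = x ≡ u
OnCycle (cyc2 u v _ _) x = x ≡ u ⊎ x ≡ v
OnCycle (cycL C)       x = ∃[ i ] vtx C i ≡ x

Reach : ∀ {n} → SG n → Fin n → Fin n → Set
Reach G = Star (Adj G)

-- r is the least vertex of its connected component (one representative per component)
IsRep : ∀ {n} → SG n → Fin n → Set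
IsRep G r = ∀ u → Reach G r u → r Fin.≤ u

BalancedComp : ∀ {n} → SG n → Fin n → Set
BalancedComp G r = ∀ (C : AnyCycle G) → (∃[ x ] (OnCycle C x × Reach G r x)) → BalancedCycle C

NumBalComp : ∀ {n} → SG n → ℕ → Set
NumBalComp {n} G b =
  Σ (List (Fin n)) λ rs → length rs ≡ b × Unique rs ×
    (∀ r → (r ∈ rs) ⇔ (IsRep G r × BalancedComp G r))

HasRank : ∀ {n} → SG n → ℕ → Set
HasRank {n} G r = Σ ℕ λ b → NumBalComp G b × r ≡ n ∸ b

-- Λ_k = {0, ±1, …, ±k}
Λ : ℕ → List ℤ
Λ k = + 0 ∷ concatMap (λ i → + suc i ∷ - (+ suc i) ∷ []) (upTo k)

allVecs : ∀ {A : Set} → List A → (n : ℕ) → List (Vec A n)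
allVecs xs zero    = Vec.[] ∷ []
allVecs xs (suc n) = concatMap (λ x → map (x Vec.∷_) (allVecs xs n)) xs

Proper : ∀ {n} → SG n → (Fin n → ℤ) → Set
Proper G γ =
  (∀ i j → pos G i j ≡ true → γ i ≢ γ j) ×
  (∀ i j → neg G i j ≡ true → γ i ≢ - γ j) ×
  (∀ i → loop G i ≡ true → γ i ≢ + 0)

private
  _≟B_ = Data.Bool._≟_ where import Data.Bool

proper? : ∀ {n} (G : SG n) → Decidable (λ (γ : Vec ℤ n) → Proper G (lookup γ))
proper? G γ =
  all? (λ i → all? (λ j → (pos G i j ≟B true) →-dec ¬? (lookup γ i ℤ.≟ lookup γ j))) ×-dec
  (all? (λ i → all? (λ j → (neg G i j ≟B true) →-dec ¬? (lookup γ i ℤ.≟ - lookup γ j))) ×-dec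
   all? (λ i → (loop G i ≟B true) →-dec ¬? (lookup γ i ℤ.≟ + 0)))

-- number of proper k-colorings γ : V_G → Λ_k ; this is χ(G, 2k+1)
numColorings : ∀ {n} → SG n → ℕ → ℕ
numColorings {n} G k = length (filter (proper? G) (allVecs (Λ k) n))

degree : ∀ {n} → SG n → Fin n → ℕ
degree {n} G v = length (filterᵇ (pos G v) (allFin n)) + length (filterᵇ (neg G v) (allFin n))
                 + (if loop G v then 1 else 0)

NonConsecutive : ∀ {n} {G : SG n} (C : Cycle G) → Fin (len C) → Fin (len C) → Set
NonConsecutive C i j = nextPos i ≢ j × nextPos j ≢ i

-- a balanced chord: an edge of sign s between vtx i and vtx j (i < j, not
-- consecutive, hence not an edge of C) such that both cycles
-- vtx i … vtx j + chord   and   vtx j … vtx (k-1), vtx 0 … vtx i + chord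
-- are balanced.
HasBalancedChord : ∀ {n} {G : SG n} → Cycle G → Set
HasBalancedChord {G = G} C =
  ∃[ i ] ∃[ j ] ∃[ s ]
    (toℕ i ℕ.< toℕ j × NonConsecutive C i j × HasEdge G s (vtx C i) (vtx C j) ×
     EvenN (negsIn C (toℕ i) (toℕ j) + (if isNeg s then 1 else 0)) ×
     EvenN ((negs C ∸ negsIn C (toℕ i) (toℕ j)) + (if isNeg s then 1 else 0)))

BalancedChordal : ∀ {n} → SG n → Set
BalancedChordal G = ∀ (C : Cycle G) → EvenN (negs C) → 4 ℕ.≤ len C → HasBalancedChord C

module Submission where

-- All four parts rest on the triangle lemma (`triangle`): two distinct neighbours
-- u₁, u₂ of v are joined by an edge whose sign is the product of the signs of u₁v
-- and vu₂; moreover a loop at v, or a double edge at v, forces loops on neighbours.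
-- (1) Contracting {v,w} only adds edges uw with u a neighbour of v, and loops at w;
--     the triangle lemma shows they are already present, so G/(v,w) = G ∖ {v}.
-- (3) A colouring γ of F = G ∖ {v} extends to v by exactly the colours not forbidden
--     by v's neighbours and loop. For proper γ the forbidden colours are deg v distinct
--     members of Λ_k (triangle lemma again), so γ has (2k+1) - deg v proper
--     extensions; summing over γ gives χ(G, t) = (t - d) χ(F, t) at t = 2k+1.
-- (4) A balanced cycle of length ≥ 4 through v has the chord joining the two
--     neighbours of v on it, which cuts off a balanced triangle; cycles avoiding v
--     are cycles of F, and cycles of F are cycles of G.
-- (2) Walks and long cycles through v can be shortcut past v, keeping parity, and a
--     triangle through v is balanced unless a double edge (hence a loop) is nearby;
--     so a component of G is balanced iff its trace in F is. As v has a loop or a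
--     neighbour it is never alone in a balanced component, hence b(G) = b(F) by
--     double counting, and rank(G) = rank(F) + 1.
-- The file develops finite sums and counting, parity, positions on a cycle, walks
-- and counts of negative edges on cycles, then the consequences of the simplicial
-- condition, then the four parts; the proposition itself comes last.

module FiniteSums where

  open import Data.Nat using (ℕ; suc; _+_; _*_; _≤_; z≤n; s≤s)
  open import Data.Bool using (true; false)
  open import Data.Nat.Properties
    using (+-assoc; *-distribʳ-+; ≤-trans; n≤1+n; +-commutativeSemigroup; module ≤-Reasoning)
  open import Algebra.Properties.CommutativeSemigroup +-commutativeSemigroup using (interchange)
  open import Data.List using (List; []; _∷_; _++_; map; concatMap; filter; length; allFin)
  open import Data.List.Properties using (length-tabulate)
  open import Data.List.Relation.Unary.All as All using (All; []; _∷_)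
  open import Data.List.Relation.Unary.Unique.Propositional using (Unique; []; _∷_)
  import Data.List.Relation.Unary.Unique.Propositional.Properties as Unique
  open import Data.List.Membership.Propositional using (_∈_)
  open import Data.List.Membership.Propositional.Properties using (∈-allFin)
  open import Data.List.Relation.Unary.Any using (here; there)
  open import Data.Fin using (Fin)
  import Data.Fin as Fin
  open import Relation.Binary.PropositionalEquality using (_≡_; _≢_; refl; sym; trans; cong; cong₂)
  open import Relation.Binary.Definitions using (DecidableEquality)
  open import Relation.Nullary using (Dec; yes; no; _because_; ¬_)
  open import Data.Empty using (⊥-elim)
  open import Function using (_∘_)

  Σ : ∀ {A : Set} → (A → ℕ) → List A → ℕ
  Σ f []      = 0
  Σ f (x ∷ L) = f x + Σ f L

  private variable
    A B : Set

  Σ-++ : ∀ (f : A → ℕ) L M → Σ f (L ++ M) ≡ Σ f L + Σ f M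
  Σ-++ f []      M = refl
  Σ-++ f (x ∷ L) M = trans (cong (f x +_) (Σ-++ f L M)) (sym (+-assoc (f x) _ _))

  Σ-map : ∀ (f : B → ℕ) (g : A → B) L → Σ f (map g L) ≡ Σ (f ∘ g) L
  Σ-map f g []      = refl
  Σ-map f g (x ∷ L) = cong (f (g x) +_) (Σ-map f g L)

  Σ-concatMap : ∀ (f : B → ℕ) (g : A → List B) L → Σ f (concatMap g L) ≡ Σ (λ x → Σ f (g x)) L
  Σ-concatMap f g []      = refl
  Σ-concatMap f g (x ∷ L) = trans (Σ-++ f (g x) _) (cong (Σ f (g x) +_) (Σ-concatMap f g L))

  Σ-cong : ∀ {f g : A → ℕ} L → (∀ x → f x ≡ g x) → Σ f L ≡ Σ g L
  Σ-cong []      e = refl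
  Σ-cong (x ∷ L) e = cong₂ _+_ (e x) (Σ-cong L e)

  Σ-cong-All : ∀ {P : A → Set} {f g : A → ℕ} {L} → All P L → (∀ x → P x → f x ≡ g x) → Σ f L ≡ Σ g L
  Σ-cong-All []       e = refl
  Σ-cong-All (p ∷ ps) e = cong₂ _+_ (e _ p) (Σ-cong-All ps e)

  Σ-cong-∈ : ∀ {f g : A → ℕ} L → (∀ x → x ∈ L → f x ≡ g x) → Σ f L ≡ Σ g L
  Σ-cong-∈ L e = Σ-cong-All (All.tabulate (λ x∈L → x∈L)) e

  Σ-+ : ∀ (f g : A → ℕ) L → Σ (λ x → f x + g x) L ≡ Σ f L + Σ g L
  Σ-+ f g []      = refl
  Σ-+ f g (x ∷ L) = trans (cong (f x + g x +_) (Σ-+ f g L)) (interchange (f x) (g x) (Σ f L) (Σ g L))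

  Σ-*ʳ : ∀ (f : A → ℕ) c L → Σ (λ x → f x * c) L ≡ Σ f L * c
  Σ-*ʳ f c []      = refl
  Σ-*ʳ f c (x ∷ L) = trans (cong (f x * c +_) (Σ-*ʳ f c L)) (sym (*-distribʳ-+ c (f x) _))

  Σ-zero : ∀ (L : List A) → Σ (λ _ → 0) L ≡ 0
  Σ-zero []      = refl
  Σ-zero (x ∷ L) = Σ-zero L

  Σ-one : ∀ (L : List A) → Σ (λ _ → 1) L ≡ length L
  Σ-one []      = refl
  Σ-one (x ∷ L) = cong suc (Σ-one L)

  Σ-swap : ∀ (f : A → B → ℕ) L (M : List B) → Σ (λ x → Σ (f x) M) L ≡ Σ (λ y → Σ (λ x → f x y) L) M
  Σ-swap f []      M = sym (Σ-zero M)
  Σ-swap f (x ∷ L) M =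
    trans (cong (Σ (f x) M +_) (Σ-swap f L M)) (sym (Σ-+ (f x) (λ y → Σ (λ x → f x y) L) M))

  ind : ∀ {p} {P : Set p} → Dec P → ℕ
  ind (true  because _) = 1
  ind (false because _) = 0

  ind-yes : ∀ {p} {P : Set p} (d : Dec P) → P → ind d ≡ 1
  ind-yes (yes _)  _ = refl
  ind-yes (no ¬p)  p = ⊥-elim (¬p p)

  ind-no : ∀ {p} {P : Set p} (d : Dec P) → ¬ P → ind d ≡ 0
  ind-no (yes p) ¬p = ⊥-elim (¬p p)
  ind-no (no _)  _  = refl

  ind-iff : ∀ {p q} {P : Set p} {Q : Set q} (d : Dec P) (e : Dec Q) → (P → Q) → (Q → P) → ind d ≡ ind e
  ind-iff (yes p)  e f g = sym (ind-yes e (f p))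
  ind-iff (no ¬p)  e f g = sym (ind-no e (¬p ∘ g))

  ind-compl : ∀ {p q} {P : Set p} {Q : Set q} (d : Dec P) (e : Dec Q) →
              (P → ¬ Q) → (¬ Q → P) → ind d + ind e ≡ 1
  ind-compl (yes p)  (yes q)  f g = ⊥-elim (f p q)
  ind-compl (yes p)  (no _)   f g = refl
  ind-compl (no _)   (yes _)  f g = refl
  ind-compl (no ¬p)  (no ¬q)  f g = ⊥-elim (¬p (g ¬q))

  length-filter : ∀ {p} {P : A → Set p} (P? : (x : A) → Dec (P x)) L → length (filter P? L) ≡ Σ (ind ∘ P?) L
  length-filter P? [] = refl
  length-filter P? (x ∷ L) with P? x
  ... | true  because _ = cong suc (length-filter P? L)
  ... | false because _ = length-filter P? L

  Unique-map : ∀ (f : A → B) (L : List A) → Unique L →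
               (∀ a b → a ∈ L → b ∈ L → a ≢ b → f a ≢ f b) → Unique (map f L)
  Unique-map f []      []      inj = []
  Unique-map f (x ∷ L) (x∉ ∷ u) inj =
    fresh L x∉ (λ b b∈ → inj x b (here refl) (there b∈)) ∷
    Unique-map f L u (λ a b a∈ b∈ → inj a b (there a∈) (there b∈))
    where
    fresh : ∀ M → All (x ≢_) M → (∀ b → b ∈ M → x ≢ b → f x ≢ f b) → All (f x ≢_) (map f M)
    fresh []      []       k = []
    fresh (y ∷ M) (p ∷ ps) k = k y (here refl) p ∷ fresh M ps (λ b b∈ → k b (there b∈))

  module Count {A : Set} (_≟_ : DecidableEquality A) where
    open import Data.List.Membership.DecPropositional _≟_ using (_∈?_)

    ∈-as-Σ : ∀ (x : A) L → Unique L → ind (x ∈? L) ≡ Σ (λ y → ind (x ≟ y)) L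
    ∈-as-Σ x []      []       = refl
    ∈-as-Σ x (y ∷ L) (x∉ ∷ u) with x ≟ y
    ... | yes refl = cong suc (sym (trans (Σ-cong-All x∉ (λ z x≢z → ind-no (x ≟ z) x≢z)) (Σ-zero L)))
    ... | no x≢y with x ∈? L | ∈-as-Σ x L u
    ...    | yes _ | e = e
    ...    | no _  | e = e

    occurs-once : ∀ (x : A) L → Unique L → x ∈ L → Σ (λ y → ind (y ≟ x)) L ≡ 1
    occurs-once x L u x∈ =
      trans (Σ-cong L (λ y → ind-iff (y ≟ x) (x ≟ y) sym sym))
            (trans (sym (∈-as-Σ x L u)) (ind-yes (x ∈? L) x∈))

    exactly-one : ∀ {P : A → Set} (P? : ∀ x → Dec (P x)) L → Unique L →
                  ∀ x → x ∈ L → P x → (∀ y → y ∈ L → P y → y ≡ x) → Σ (ind ∘ P?) L ≡ 1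
    exactly-one P? L u x x∈ px uniq =
      trans (Σ-cong-∈ L (λ y y∈ → ind-iff (P? y) (y ≟ x) (uniq y y∈) (λ { refl → px })))
            (occurs-once x L u x∈)

    count-members : ∀ (L M : List A) → Unique M → All (λ m → Σ (λ y → ind (y ≟ m)) L ≡ 1) M →
                    Σ (λ x → ind (x ∈? M)) L ≡ length M
    count-members L M uM once =
      trans (Σ-cong L (λ x → ∈-as-Σ x M uM))
     (trans (Σ-swap (λ x y → ind (x ≟ y)) L M)
     (trans (Σ-cong-All once (λ _ e → e)) (Σ-one M)))

  Unique-length-≤ : ∀ n (L : List (Fin n)) → Unique L → length L ≤ n
  Unique-length-≤ n L u = begin
    length L                                  ≡⟨ sym (Σ-one L) ⟩
    Σ (λ _ → 1) L                              ≡⟨ Σ-cong L (λ x → sym (occurs-once x (allFin n) (Unique.allFin⁺ n) (∈-allFin x))) ⟩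
    Σ (λ x → Σ (λ y → ind (y Fin.≟ x)) (allFin n)) L ≡⟨ Σ-swap (λ x y → ind (y Fin.≟ x)) L (allFin n) ⟩
    Σ (λ y → Σ (λ x → ind (y Fin.≟ x)) L) (allFin n) ≡⟨ Σ-cong (allFin n) (λ y → sym (∈-as-Σ y L u)) ⟩
    Σ (λ y → ind (y ∈? L)) (allFin n)          ≤⟨ indicators≤ (allFin n) ⟩
    Σ (λ _ → 1) (allFin n)                     ≡⟨ trans (Σ-one (allFin n)) (length-tabulate (λ x → x)) ⟩
    n                                          ∎
    where
    open Count (Fin._≟_ {n})
    open import Data.List.Membership.DecPropositional (Fin._≟_ {n}) using (_∈?_)
    open ≤-Reasoning
    indicators≤ : ∀ M → Σ (λ y → ind (y ∈? L)) M ≤ Σ (λ _ → 1) M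
    indicators≤ []      = z≤n
    indicators≤ (y ∷ M) with y ∈? L
    ... | yes _ = s≤s (indicators≤ M)
    ... | no _  = ≤-trans (indicators≤ M) (n≤1+n _)

module Parity where

  open import Defs using (EvenN)
  open import Data.Bool using (Bool; true; false; not; _xor_; if_then_else_)
  open import Data.Nat using (ℕ; zero; suc; _+_; _∸_; _≤_; _%_)
  open import Data.Nat.Properties using (m∸n+n≡m; m+[n∸m]≡n)
  open import Data.Bool.Properties using (not-involutive)
  open import Data.Nat.DivMod using (%-distribˡ-+)
  open import Relation.Binary.PropositionalEquality using (_≡_; refl; sym; trans; cong; subst)

  -- Parity as a Boolean; it turns sums into xor, so parity arguments become
  -- finite Boolean checks.
  odd : ℕ → Bool
  odd zero    = false
  odd (suc k) = not (odd k)

  odd-+ : ∀ a b → odd (a + b) ≡ odd a xor odd b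
  odd-+ zero    b = refl
  odd-+ (suc a) b = trans (cong not (odd-+ a b)) (not-xor (odd a) (odd b))
    where
    not-xor : ∀ x y → not (x xor y) ≡ not x xor y
    not-xor true  y = not-involutive y
    not-xor false y = refl

  -- the 0/1 value of a Boolean, written as in the definition of a balanced chord
  bit : Bool → ℕ
  bit b = if b then 1 else 0

  private
    %2≡bit : ∀ k → k % 2 ≡ bit (odd k)
    %2≡bit zero    = refl
    %2≡bit (suc k) = trans (%-distribˡ-+ 1 k 2) (trans (cong (λ r → (1 + r) % 2) (%2≡bit k)) (step (odd k)))
      where
      step : ∀ b → (1 + bit b) % 2 ≡ bit (not b)
      step true  = refl
      step false = refl

  even⇒¬odd : ∀ k → EvenN k → odd k ≡ false
  even⇒¬odd k e with odd k | %2≡bit k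
  ... | false | _ = refl
  ... | true  | h with trans (sym e) h
  ... | ()

  ¬odd⇒even : ∀ k → odd k ≡ false → EvenN k
  ¬odd⇒even k e = trans (%2≡bit k) (cong bit e)

  even-trans : ∀ a b c → EvenN (a + b) → EvenN (b + c) → EvenN (a + c)
  even-trans a b c ab bc = ¬odd⇒even (a + c) (trans (odd-+ a c)
    (xor-trans (odd a) (odd b) (odd c) (trans (sym (odd-+ a b)) (even⇒¬odd (a + b) ab)) (trans (sym (odd-+ b c)) (even⇒¬odd (b + c) bc))))
    where
    xor-trans : ∀ x y z → x xor y ≡ false → y xor z ≡ false → x xor z ≡ false
    xor-trans true  true  true  _ _ = refl
    xor-trans false false false _ _ = refl
    xor-trans true  false _     () _
    xor-trans false true  _     () _
    xor-trans true  true  false _ ()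
    xor-trans false false true  _ ()

  even-transfer : ∀ a b c d → a + b ≡ c + d → EvenN a → EvenN (b + d) → EvenN c
  even-transfer a b c d eq ea ebd = ¬odd⇒even c (xor-transfer (odd a) (odd b) (odd c) (odd d)
    (trans (sym (odd-+ a b)) (trans (cong odd eq) (odd-+ c d)))
    (even⇒¬odd a ea) (trans (sym (odd-+ b d)) (even⇒¬odd (b + d) ebd)))
    where
    xor-transfer : ∀ x y z w → x xor y ≡ z xor w → x ≡ false → y xor w ≡ false → z ≡ false
    xor-transfer false false false _     _  _ _  = refl
    xor-transfer false true  false _     _  _ _  = refl
    xor-transfer false false true  false () _ _
    xor-transfer false false true  true  _  _ ()
    xor-transfer false true  true  false _  _ ()
    xor-transfer false true  true  true  () _ _
    xor-transfer true  _     _     _     _  () _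

  even-complement : ∀ N X c → EvenN N → X ≤ N → EvenN (X + c) → EvenN ((N ∸ X) + c)
  even-complement N X c eN X≤N = even-trans (N ∸ X) X c (subst EvenN (sym (m∸n+n≡m X≤N)) eN)

  even-complement′ : ∀ N X c → EvenN N → X ≤ N → EvenN ((N ∸ X) + c) → EvenN (X + c)
  even-complement′ N X c eN X≤N = even-trans X (N ∸ X) c (subst EvenN (sym (m+[n∸m]≡n X≤N)) eN)

module CyclePositions where

  open import Defs using (nextPos)
  open import Data.Nat as ℕ using (ℕ; zero; suc; _<_; _≤_; s≤s; z≤n; _%_)
  import Data.Nat.Properties as ℕ
  open import Data.Nat.DivMod using (m<n⇒m%n≡m; n%n≡0)
  open import Data.Fin as Fin using (Fin; toℕ; fromℕ<; punchIn)
  open import Data.Fin.Properties using (toℕ-fromℕ<; toℕ<n; toℕ-injective)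
  open import Data.Product using (_,_; ∃-syntax)
  open import Relation.Binary.PropositionalEquality using (_≡_; _≢_; refl; sym; trans; cong; subst)
  open import Relation.Nullary using (yes; no)
  open import Relation.Binary.Definitions using (tri<; tri≈; tri>)

  nextPos-< : ∀ {K} (x : Fin (suc K)) → suc (toℕ x) < suc K → toℕ (nextPos x) ≡ suc (toℕ x)
  nextPos-< x p = trans (toℕ-fromℕ< _) (m<n⇒m%n≡m p)

  nextPos-last : ∀ {K} (x : Fin (suc K)) → suc (toℕ x) ≡ suc K → toℕ (nextPos x) ≡ 0
  nextPos-last {K} x p = trans (toℕ-fromℕ< _) (trans (cong (_% suc K) p) (n%n≡0 (suc K)))

  data NextPosView {K} (x : Fin (suc K)) : Set where
    inner : suc (toℕ x) < suc K → toℕ (nextPos x) ≡ suc (toℕ x) → NextPosView x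
    last  : suc (toℕ x) ≡ suc K → toℕ (nextPos x) ≡ 0 → NextPosView x

  nextPos-view : ∀ {K} (x : Fin (suc K)) → NextPosView x
  nextPos-view {K} x with suc (toℕ x) ℕ.<? suc K
  ... | yes p = inner p (nextPos-< x p)
  ... | no ¬p = last x+1≡ (nextPos-last x x+1≡)
    where x+1≡ = ℕ.≤-antisym (toℕ<n x) (ℕ.≮⇒≥ ¬p)

  nextPos-injective : ∀ {K} (x y : Fin (suc K)) → nextPos x ≡ nextPos y → x ≡ y
  nextPos-injective x y e with nextPos-view x | nextPos-view y | cong toℕ e
  ... | inner _ ex | inner _ ey | e′ = toℕ-injective (ℕ.suc-injective (trans (sym ex) (trans e′ ey)))
  ... | last lx _  | last ly _  | _  = toℕ-injective (ℕ.suc-injective (trans lx (sym ly)))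
  ... | inner _ ex | last _ ey  | e′ with trans (sym ex) (trans e′ ey)
  ... | ()
  nextPos-injective x y e | last _ ex | inner _ ey | e′ with trans (sym ey) (trans (sym e′) ex)
  ... | ()

  nextPos-≢ : ∀ {K} (x : Fin (suc (suc K))) → nextPos x ≢ x
  nextPos-≢ x e with nextPos-view x | cong toℕ e
  ... | inner _ ex | e′ = ℕ.<⇒≢ (ℕ.n<1+n (toℕ x)) (sym (trans (sym ex) e′))
  ... | last lx ex | e′ with ℕ.suc-injective (trans (cong suc (sym (trans (sym e′) ex))) lx)
  ... | ()

  predecessor : ∀ {K} (P : Fin (suc K)) → ∃[ Q ] nextPos Q ≡ P
  predecessor {K} P with toℕ P in eq
  ... | zero  = Q , toℕ-injective (trans (nextPos-last Q (cong suc (toℕ-fromℕ< {K} {suc K} ℕ.≤-refl))) (sym eq))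
    where Q = fromℕ< {K} {suc K} ℕ.≤-refl
  ... | suc p = Q , toℕ-injective (trans (nextPos-< Q (subst (λ z → suc z < suc K) (sym tQ) p+1<)) (trans (cong suc tQ) (sym eq)))
    where
    p+1< : suc p < suc K
    p+1< = subst (_< suc K) eq (toℕ<n P)
    Q = fromℕ< (ℕ.<-trans (ℕ.n<1+n p) p+1<)
    tQ : toℕ Q ≡ p
    tQ = toℕ-fromℕ< _

  toℕ-punchIn-< : ∀ {K} (i : Fin (suc K)) (j : Fin K) → toℕ j < toℕ i → toℕ (punchIn i j) ≡ toℕ j
  toℕ-punchIn-< Fin.zero    j          ()
  toℕ-punchIn-< (Fin.suc i) Fin.zero    _       = refl
  toℕ-punchIn-< (Fin.suc i) (Fin.suc j) (s≤s p) = cong suc (toℕ-punchIn-< i j p)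

  toℕ-punchIn-≥ : ∀ {K} (i : Fin (suc K)) (j : Fin K) → toℕ i ≤ toℕ j → toℕ (punchIn i j) ≡ suc (toℕ j)
  toℕ-punchIn-≥ Fin.zero    j           _       = refl
  toℕ-punchIn-≥ (Fin.suc i) Fin.zero    ()
  toℕ-punchIn-≥ (Fin.suc i) (Fin.suc j) (s≤s p) = cong suc (toℕ-punchIn-≥ i j p)

  nextPos-≡< : ∀ {K} {x : Fin (suc K)} {m} → toℕ x ≡ m → suc m < suc K → toℕ (nextPos x) ≡ suc m
  nextPos-≡< {x = x} refl = nextPos-< x

  nextPos-≡last : ∀ {K} {x : Fin (suc K)} {m} → toℕ x ≡ m → suc m ≡ suc K → toℕ (nextPos x) ≡ 0
  nextPos-≡last {x = x} refl = nextPos-last x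

  -- Deleting position P from a cycle of length K + 2 leaves the positions punchIn P k,
  -- k : Fin (K + 1). Consecutive positions k, nextPos k stay consecutive, unless P
  -- lay between them.
  data AfterRemoval {K} (P : Fin (suc (suc K))) (k : Fin (suc K)) : Set where
    consecutive : nextPos (punchIn P k) ≡ punchIn P (nextPos k) → AfterRemoval P k
    around      : nextPos (punchIn P k) ≡ P → nextPos P ≡ punchIn P (nextPos k) → AfterRemoval P k

  after-removal-< : ∀ {K} (P : Fin (suc (suc K))) (k : Fin (suc K)) →
                    suc (toℕ k) < suc K → toℕ (nextPos k) ≡ suc (toℕ k) → AfterRemoval P k
  after-removal-< {K} P k k+1<K+1 ek with ℕ.<-cmp (suc (toℕ k)) (toℕ P)
  ... | tri< k+1<P _ _ = consecutive (toℕ-injective (trans (nextPos-≡< ak (ℕ.m<n⇒m<1+n k+1<K+1)) (sym ak⁺)))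
    where
    ak  = toℕ-punchIn-< P k (ℕ.<-trans (ℕ.n<1+n (toℕ k)) k+1<P)
    ak⁺ = trans (toℕ-punchIn-< P (nextPos k) (subst (_< toℕ P) (sym ek) k+1<P)) ek
  ... | tri≈ _ k+1≡P _ = around (toℕ-injective (trans (nextPos-≡< ak (ℕ.m<n⇒m<1+n k+1<K+1)) k+1≡P))
                                (toℕ-injective (trans (nextPos-≡< (sym k+1≡P) (s≤s k+1<K+1)) (sym ak⁺)))
    where
    ak  = toℕ-punchIn-< P k (subst (toℕ k <_) k+1≡P (ℕ.n<1+n (toℕ k)))
    ak⁺ = trans (toℕ-punchIn-≥ P (nextPos k) (subst (toℕ P ≤_) (sym ek) (ℕ.≤-reflexive (sym k+1≡P)))) (cong suc ek)
  ... | tri> _ _ P<k+1 = consecutive (toℕ-injective (trans (nextPos-≡< ak (s≤s k+1<K+1)) (sym ak⁺)))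
    where
    ak  = toℕ-punchIn-≥ P k (ℕ.≤-pred P<k+1)
    ak⁺ = trans (toℕ-punchIn-≥ P (nextPos k) (subst (toℕ P ≤_) (sym ek) (ℕ.m≤n⇒m≤1+n (ℕ.≤-pred P<k+1)))) (cong suc ek)

  after-removal-last : ∀ {K} (P : Fin (suc (suc K))) (k : Fin (suc K)) →
                       suc (toℕ k) ≡ suc K → toℕ (nextPos k) ≡ 0 → AfterRemoval P k
  after-removal-last {K} P k k-last ek with toℕ k ℕ.<? toℕ P | toℕ P ℕ.≟ 0
  ... | yes k<P | _ = around (toℕ-injective (trans (nextPos-≡< ak (subst (_< suc (suc K)) (sym k-last) (ℕ.n<1+n (suc K)))) (sym P≡)))
                             (toℕ-injective (trans (nextPos-≡last P≡ (cong suc k-last)) (sym ak⁺)))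
    where
    P≡ : toℕ P ≡ suc (toℕ k)
    P≡ = ℕ.≤-antisym (subst (toℕ P ≤_) (sym k-last) (ℕ.≤-pred (toℕ<n P))) k<P
    ak  = toℕ-punchIn-< P k k<P
    ak⁺ = trans (toℕ-punchIn-< P (nextPos k) (subst (_< toℕ P) (sym ek) (subst (0 <_) (sym P≡) (s≤s z≤n)))) ek
  ... | no k≮P | yes P≡0 = around (toℕ-injective (trans (nextPos-≡last ak (cong suc k-last)) (sym P≡0)))
                                  (toℕ-injective (trans (nextPos-≡< P≡0 (s≤s (s≤s z≤n))) (sym ak⁺)))
    where
    ak  = toℕ-punchIn-≥ P k (ℕ.≮⇒≥ k≮P)
    ak⁺ = trans (toℕ-punchIn-≥ P (nextPos k) (subst (toℕ P ≤_) (sym ek) (ℕ.≤-reflexive P≡0))) (cong suc ek)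
  ... | no k≮P | no P≢0 = consecutive (toℕ-injective (trans (nextPos-≡last ak (cong suc k-last)) (sym ak⁺)))
    where
    ak  = toℕ-punchIn-≥ P k (ℕ.≮⇒≥ k≮P)
    ak⁺ = trans (toℕ-punchIn-< P (nextPos k) (subst (_< toℕ P) (sym ek) (ℕ.n≢0⇒n>0 P≢0))) ek

  after-removal : ∀ {K} (P : Fin (suc (suc K))) (k : Fin (suc K)) → AfterRemoval P k
  after-removal P k with nextPos-view k
  ... | inner k+1<K+1 ek = after-removal-< P k k+1<K+1 ek
  ... | last k-last ek    = after-removal-last P k k-last ek

module Walks where

  open import Defs
  open CyclePositions using (nextPos-≡<)
  open import Data.Bool using (true)
  import Data.Bool as Bool
  open import Data.Nat as ℕ using (ℕ; zero; suc; _<_; s≤s; z≤n)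
  import Data.Nat.Properties as ℕ
  open import Data.Fin as Fin using (Fin; zero; suc; toℕ; fromℕ<; punchIn; punchOut)
  open import Data.Fin.Properties using (toℕ-fromℕ<; toℕ<n; toℕ-injective; fromℕ<-toℕ; punchIn-punchOut; punchOut-cong; any?)
  open import Data.Product using (_×_; _,_; ∃; ∃-syntax)
  open import Data.Sum using (_⊎_; inj₁; inj₂)
  open import Relation.Binary.PropositionalEquality using (_≡_; _≢_; refl; sym; trans; cong; subst; subst₂)
  open import Relation.Nullary using (Dec; yes; no)
  open import Relation.Nullary.Decidable using (map′; _×-dec_; _⊎-dec_)
  open import Relation.Binary.Construct.Closure.ReflexiveTransitive using (Star; ε; _◅_; _◅◅_; gmap; reverse)
  open import Data.Empty using (⊥-elim)

  -- Reachability along a decidable relation on a finite set is decidable: a walk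
  -- from a to b ≠ a can be taken to leave a once and never return, so it is a step
  -- from a followed by a walk in the relation restricted to the other vertices.
  reach? : ∀ n (R : Fin n → Fin n → Set) → (∀ x y → Dec (R x y)) → ∀ a b → Dec (Star R a b)
  reach? (suc m) R R? a b with a Fin.≟ b
  ... | yes refl = yes ε
  ... | no a≢b = map′ sound complete
                   (any? (λ c → R? a (punchIn a c) ×-dec reach? m R₋ (λ x y → R? (punchIn a x) (punchIn a y)) c b₋))
    where
    R₋ : Fin m → Fin m → Set
    R₋ x y = R (punchIn a x) (punchIn a y)
    b₋ = punchOut a≢b
    ViaLastExit = ∃ λ c → R a (punchIn a c) × Star R₋ c b₋
    sound : ViaLastExit → Star R a b
    sound (c , r , p) = r ◅ subst (Star R (punchIn a c)) (punchIn-punchOut a≢b) (gmap (punchIn a) (λ r → r) p)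
    mutual
      -- a walk from u ≠ a either avoids a or, after its last visit of a, exits it
      avoid : ∀ u (a≢u : a ≢ u) → Star R u b → Star R₋ (punchOut a≢u) b₋ ⊎ ViaLastExit
      avoid u a≢u ε = inj₁ (subst (λ z → Star R₋ z b₋) (punchOut-cong a refl) ε)
      avoid u a≢u (_◅_ {j = w} r p) with a Fin.≟ w
      ... | yes refl = inj₂ (complete p)
      ... | no a≢w with avoid w a≢w p
      ...   | inj₁ q = inj₁ (subst₂ R (sym (punchIn-punchOut a≢u)) (sym (punchIn-punchOut a≢w)) r ◅ q)
      ...   | inj₂ x = inj₂ x
      complete : Star R a b → ViaLastExit
      complete ε = ⊥-elim (a≢b refl)
      complete (_◅_ {j = w} r p) with a Fin.≟ w
      ... | yes refl = complete p
      ... | no a≢w with avoid w a≢w p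
      ...   | inj₁ q = punchOut a≢w , subst (R a) (sym (punchIn-punchOut a≢w)) r , q
      ...   | inj₂ x = x

  least-witness : ∀ n (P : Fin n → Set) → (∀ x → Dec (P x)) → ∀ x → P x → ∃[ r ] P r × (∀ y → P y → r Fin.≤ y)
  least-witness (suc m) P P? x px with P? zero
  ... | yes p0 = zero , p0 , (λ y _ → z≤n)
  ... | no ¬p0 with x
  ...   | zero   = ⊥-elim (¬p0 px)
  ...   | suc x′ with least-witness m (λ z → P (suc z)) (λ z → P? (suc z)) x′ px
  ...     | r , pr , least = suc r , pr , least′
    where
    least′ : ∀ y → P y → suc r Fin.≤ y
    least′ zero    py = ⊥-elim (¬p0 py)
    least′ (suc y) py = s≤s (least y py)

  module SymmetricWalks {n} (H : SG n) (S : Simple H) where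
    open Simple S

    Adj-sym : ∀ {x y} → Adj H x y → Adj H y x
    Adj-sym {x} {y} (inj₁ e) = inj₁ (trans (pos-sym y x) e)
    Adj-sym {x} {y} (inj₂ e) = inj₂ (trans (neg-sym y x) e)

    Reach-sym : ∀ {x y} → Reach H x y → Reach H y x
    Reach-sym = reverse Adj-sym

    Reach? : ∀ x y → Dec (Reach H x y)
    Reach? = reach? n (Adj H) (λ x y → (pos H x y Bool.≟ true) ⊎-dec (neg H x y Bool.≟ true))

    edge⇒Adj : ∀ s {x y} → HasEdge H s x y → Adj H x y
    edge⇒Adj ⊕ e = inj₁ e
    edge⇒Adj ⊖ e = inj₂ e

    last-step : ∀ {a b} → Reach H a b → a ≢ b → ∃[ w ] Reach H a w × Adj H w b
    last-step ε       a≢b = ⊥-elim (a≢b refl)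
    last-step (r ◅ p) _   = go r p
      where
      go : ∀ {a u b} → Adj H a u → Reach H u b → ∃[ w ] Reach H a w × Adj H w b
      go r ε        = _ , ε , r
      go r (r′ ◅ p) with go r′ p
      ... | w , q , r″ = w , r ◅ q , r″

    cycle-connected : ∀ (C : Cycle H) i j → Reach H (vtx C i) (vtx C j)
    cycle-connected C i j = Reach-sym (from0 i) ◅◅ from0 j
      where
      step : ∀ k (p : suc k < len C) → Reach H (vtx C zero) (vtx C (fromℕ< (ℕ.<-trans (ℕ.n<1+n k) p))) →
             Reach H (vtx C zero) (vtx C (fromℕ< p))
      step k p w = w ◅◅ (edge⇒Adj (sgn C X) (subst (λ z → HasEdge H (sgn C X) (vtx C X) (vtx C z)) X⁺≡ (edge C X)) ◅ ε)
        where
        X = fromℕ< (ℕ.<-trans (ℕ.n<1+n k) p)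
        X⁺≡ : nextPos X ≡ fromℕ< p
        X⁺≡ = toℕ-injective (trans (nextPos-≡< (toℕ-fromℕ< _) p) (sym (toℕ-fromℕ< p)))
      upTo : ∀ k (p : k < len C) → Reach H (vtx C zero) (vtx C (fromℕ< p))
      upTo zero    p = ε
      upTo (suc k) p = step k p (upTo k (ℕ.<-trans (ℕ.n<1+n k) p))
      from0 : ∀ i → Reach H (vtx C zero) (vtx C i)
      from0 i = subst (λ z → Reach H (vtx C zero) (vtx C z)) (fromℕ<-toℕ i (toℕ<n i)) (upTo (toℕ i) (toℕ<n i))

module CycleSums where

  open import Defs
  open Parity using (bit)
  open import Data.Bool using (Bool; true; false; T; _∧_)
  open import Data.Nat as ℕ using (ℕ; zero; suc; _+_; _*_; _≤_; _≤ᵇ_; _<ᵇ_; z≤n)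
  import Data.Nat.Properties as ℕ
  open import Algebra.Properties.CommutativeMonoid.Sum ℕ.+-0-commutativeMonoid
    using (sum; sum-remove; ∑-distrib-+; sum-cong-≗; sum-replicate-zero)
  open import Data.Fin as Fin using (Fin; toℕ)
  open import Data.Fin.Properties using (toℕ<n; toℕ-injective; punchInᵢ≢i)
  open import Data.List using (length; filterᵇ; tabulate)
  open import Relation.Binary.PropositionalEquality using (_≡_; _≢_; refl; sym; trans; cong; cong₂; module ≡-Reasoning)
  open import Relation.Nullary using (¬_; yes; no)
  open import Data.Empty using (⊥-elim)
  open import Function using (_∘_)
  open import Data.Nat.Tactic.RingSolver using (solve-∀)

  length-filterᵇ-tabulate : ∀ {A : Set} {K} (f : A → Bool) (g : Fin K → A) →
                            length (filterᵇ f (tabulate g)) ≡ sum (bit ∘ f ∘ g)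
  length-filterᵇ-tabulate {K = zero}  f g = refl
  length-filterᵇ-tabulate {K = suc K} f g with f (g Fin.zero)
  ... | true  = cong suc (length-filterᵇ-tabulate f (g ∘ Fin.suc))
  ... | false = length-filterᵇ-tabulate f (g ∘ Fin.suc)

  sum-single : ∀ {K} (f : Fin (suc K) → ℕ) X → (∀ k → k ≢ X → f k ≡ 0) → sum f ≡ f X
  sum-single {K} f X zero-elsewhere = begin
    sum f                                  ≡⟨ sum-remove {i = X} f ⟩
    f X + sum (f ∘ Fin.punchIn X)          ≡⟨ cong (f X +_) (sum-cong-≗ (λ k → zero-elsewhere _ (punchInᵢ≢i X k))) ⟩
    f X + sum (λ (_ : Fin K) → 0)          ≡⟨ cong (f X +_) (sum-replicate-zero K) ⟩
    f X + 0                                ≡⟨ ℕ.+-identityʳ (f X) ⟩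
    f X                                    ∎
    where open ≡-Reasoning

  sum-update : ∀ {K} (f g : Fin (suc K) → ℕ) X → (∀ k → k ≢ X → f k ≡ g k) → sum f + g X ≡ sum g + f X
  sum-update f g X agree = begin
    sum f + g X                                   ≡⟨ cong (_+ g X) (sum-remove {i = X} f) ⟩
    f X + sum (f ∘ Fin.punchIn X) + g X           ≡⟨ cong (λ s → f X + s + g X) (sum-cong-≗ (λ k → agree _ (punchInᵢ≢i X k))) ⟩
    f X + sum (g ∘ Fin.punchIn X) + g X           ≡⟨ swap-ends (f X) _ (g X) ⟩
    g X + sum (g ∘ Fin.punchIn X) + f X           ≡⟨ cong (_+ f X) (sym (sum-remove {i = X} g)) ⟩
    sum g + f X                                   ∎
    where
    open ≡-Reasoning
    swap-ends : ∀ a b c → a + b + c ≡ c + b + a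
    swap-ends = solve-∀

  inWindow : ℕ → ℕ → ℕ → Bool
  inWindow lo hi x = (lo ≤ᵇ x) ∧ (x <ᵇ hi)

  private
    ≡true : ∀ {b} → T b → b ≡ true
    ≡true {true} _ = refl
    ≡false : ∀ {b} → ¬ T b → b ≡ false
    ≡false {true}  ¬t = ⊥-elim (¬t _)
    ≡false {false} _  = refl

  window-split : ∀ {lo mid hi} → lo ≤ mid → mid ≤ hi → ∀ x →
                 bit (inWindow lo mid x) + bit (inWindow mid hi x) ≡ bit (inWindow lo hi x)
  window-split {lo} {mid} {hi} lo≤mid mid≤hi x with x ℕ.<? mid
  ... | yes x<mid
    rewrite ≡true (ℕ.<⇒<ᵇ x<mid) | ≡false {mid ≤ᵇ x} (ℕ.<⇒≱ x<mid ∘ ℕ.≤ᵇ⇒≤ mid x)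
          | ≡true (ℕ.<⇒<ᵇ (ℕ.<-≤-trans x<mid mid≤hi)) = ℕ.+-identityʳ _
  ... | no x≮mid
    rewrite ≡false {x <ᵇ mid} (x≮mid ∘ ℕ.<ᵇ⇒< x mid) | ≡true (ℕ.≤⇒≤ᵇ (ℕ.≮⇒≥ x≮mid))
          | ≡true (ℕ.≤⇒≤ᵇ (ℕ.≤-trans lo≤mid (ℕ.≮⇒≥ x≮mid))) = refl

  window-single : ∀ {K} (X k : Fin K) → k ≢ X → bit (inWindow (toℕ X) (suc (toℕ X)) (toℕ k)) ≡ 0
  window-single X k k≢X with toℕ X ℕ.≤? toℕ k
  ... | no X≰k = cong (λ b → bit (b ∧ (toℕ k <ᵇ suc (toℕ X)))) (≡false (X≰k ∘ ℕ.≤ᵇ⇒≤ _ _))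
  ... | yes X≤k rewrite ≡true (ℕ.≤⇒≤ᵇ X≤k) =
    cong bit (≡false (λ k<X+1 → k≢X (toℕ-injective (ℕ.≤-antisym (ℕ.≤-pred (ℕ.<ᵇ⇒< _ _ k<X+1)) X≤k))))

  window-self : ∀ x → inWindow x (suc x) x ≡ true
  window-self x = trans (cong (_∧ (x <ᵇ suc x)) (≡true (ℕ.≤⇒≤ᵇ (ℕ.≤-refl {x})))) (≡true (ℕ.<⇒<ᵇ (ℕ.n<1+n x)))

  bit-∧ : ∀ a b → bit (a ∧ b) ≡ bit a * bit b
  bit-∧ true  b = sym (ℕ.*-identityˡ (bit b))
  bit-∧ false b = refl

  module NegativeEdges {n} {G : SG n} (C : Cycle G) where

    negAt : Fin (len C) → ℕ
    negAt p = bit (isNeg (sgn C p))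

    negs-sum : negs C ≡ sum negAt
    negs-sum = length-filterᵇ-tabulate (λ p → isNeg (sgn C p)) (λ p → p)

    negsIn-sum : ∀ lo hi → negsIn C lo hi ≡ sum (λ p → negAt p * bit (inWindow lo hi (toℕ p)))
    negsIn-sum lo hi = trans (length-filterᵇ-tabulate (λ p → isNeg (sgn C p) ∧ inWindow lo hi (toℕ p)) (λ p → p))
                             (sum-cong-≗ (λ p → bit-∧ (isNeg (sgn C p)) (inWindow lo hi (toℕ p))))

    negsIn-split : ∀ {lo mid hi} → lo ≤ mid → mid ≤ hi → negsIn C lo mid + negsIn C mid hi ≡ negsIn C lo hi
    negsIn-split {lo} {mid} {hi} lo≤mid mid≤hi = begin
      negsIn C lo mid + negsIn C mid hi
        ≡⟨ cong₂ _+_ (negsIn-sum lo mid) (negsIn-sum mid hi) ⟩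
      sum (λ p → negAt p * w lo mid p) + sum (λ p → negAt p * w mid hi p)
        ≡⟨ sym (∑-distrib-+ (λ p → negAt p * w lo mid p) (λ p → negAt p * w mid hi p)) ⟩
      sum (λ p → negAt p * w lo mid p + negAt p * w mid hi p)
        ≡⟨ sum-cong-≗ (λ p → trans (sym (ℕ.*-distribˡ-+ (negAt p) (w lo mid p) _))
                                   (cong (negAt p *_) (window-split lo≤mid mid≤hi (toℕ p)))) ⟩
      sum (λ p → negAt p * w lo hi p)
        ≡⟨ sym (negsIn-sum lo hi) ⟩
      negsIn C lo hi ∎
      where
      open ≡-Reasoning
      w : ℕ → ℕ → Fin (len C) → ℕ
      w lo hi p = bit (inWindow lo hi (toℕ p))

    negsIn-all : negsIn C 0 (len C) ≡ negs C
    negsIn-all = trans (negsIn-sum 0 (len C))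
                (trans (sum-cong-≗ (λ p → cong (λ b → negAt p * bit b) (≡true (ℕ.<⇒<ᵇ (toℕ<n p)))))
                (trans (sum-cong-≗ (λ p → ℕ.*-identityʳ (negAt p))) (sym negs-sum)))

    negsIn-single : ∀ X → negsIn C (toℕ X) (suc (toℕ X)) ≡ negAt X
    negsIn-single X = begin
      negsIn C (toℕ X) (suc (toℕ X))
        ≡⟨ negsIn-sum (toℕ X) (suc (toℕ X)) ⟩
      sum (λ p → negAt p * bit (inWindow (toℕ X) (suc (toℕ X)) (toℕ p)))
        ≡⟨ sum-single _ X (λ k k≢X → trans (cong (negAt k *_) (window-single X k k≢X)) (ℕ.*-zeroʳ (negAt k))) ⟩
      negAt X * bit (inWindow (toℕ X) (suc (toℕ X)) (toℕ X))
        ≡⟨ trans (cong (λ b → negAt X * bit b) (window-self (toℕ X))) (ℕ.*-identityʳ (negAt X)) ⟩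
      negAt X ∎
      where open ≡-Reasoning

    negsIn-≤ : ∀ {lo hi} → lo ≤ hi → hi ≤ len C → negsIn C lo hi ≤ negs C
    negsIn-≤ {lo} {hi} lo≤hi hi≤len = begin
      negsIn C lo hi                          ≤⟨ ℕ.m≤n+m _ (negsIn C 0 lo) ⟩
      negsIn C 0 lo + negsIn C lo hi          ≡⟨ negsIn-split z≤n lo≤hi ⟩
      negsIn C 0 hi                           ≤⟨ ℕ.m≤m+n _ (negsIn C hi (len C)) ⟩
      negsIn C 0 hi + negsIn C hi (len C)     ≡⟨ negsIn-split z≤n hi≤len ⟩
      negsIn C 0 (len C)                      ≡⟨ negsIn-all ⟩
      negs C                                  ∎
      where open ℕ.≤-Reasoning

module SimplicialVertices where

  open import Defs
  open Parity using (bit; even-transfer)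
  open CyclePositions
  open CycleSums using (sum-update; module NegativeEdges)
  open Walks using (module SymmetricWalks)
  open import Data.Nat as ℕ using (ℕ; suc; _+_)
  import Data.Nat.Properties as ℕ
  open import Algebra.Properties.CommutativeMonoid.Sum ℕ.+-0-commutativeMonoid using (sum; sum-remove)
  open import Data.Fin as Fin using (Fin; punchIn; punchOut)
  open import Data.Fin.Properties using (punchIn-injective; punchOut-injective; punchIn-punchOut; punchOut-cong; punchOut-punchIn; punchInᵢ≢i)
  open import Data.Product using (_,_; proj₁; proj₂; ∃)
  open import Data.Sum using (inj₁; inj₂)
  open import Relation.Binary.PropositionalEquality using (_≡_; _≢_; refl; sym; trans; cong; subst; subst₂; module ≡-Reasoning)
  open import Relation.Nullary using (¬_; yes; no)
  open import Relation.Binary.Construct.Closure.ReflexiveTransitive using (ε; _◅_; gmap)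
  open import Data.Empty using (⊥-elim)
  open import Function using (_∘_)
  open import Function.Definitions using (Injective)
  open import Data.Nat.Tactic.RingSolver using (solve-∀)

  _·_ : Sign → Sign → Sign
  ⊕ · b = b
  ⊖ · b = flip b

  ·-balanced : ∀ a b → EvenN (bit (isNeg a) + bit (isNeg b) + bit (isNeg (a · b)))
  ·-balanced ⊕ ⊕ = refl
  ·-balanced ⊕ ⊖ = refl
  ·-balanced ⊖ ⊕ = refl
  ·-balanced ⊖ ⊖ = refl

  delete-Simple : ∀ {n} {G : SG (suc n)} v → Simple G → Simple (delete G v)
  delete-Simple v S = record
    { pos-sym = λ a b → pos-sym _ _ ; neg-sym = λ a b → neg-sym _ _
    ; pos-irr = λ a → pos-irr _     ; neg-irr = λ a → neg-irr _ }
    where open Simple S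

  -- Throughout, v is a signed simplicial vertex of the simple signed graph G and
  -- F = G ∖ {v}; the vertex a of F is the vertex punchIn v a of G.
  module SimplicialVertex {n} (G : SG (suc n)) (v : Fin (suc n)) (S : Simple G) (ss : SignedSimplicial G v) where
    open Simple S
    open SignedSimplicial ss

    F : SG n
    F = delete G v

    module WG = SymmetricWalks G S
    module WF = SymmetricWalks F (delete-Simple v S)

    edge-sym : ∀ s a b → edgeB G s a b ≡ edgeB G s b a
    edge-sym ⊕ = pos-sym
    edge-sym ⊖ = neg-sym

    edge-delete : ∀ s a b → edgeB F s a b ≡ edgeB G s (punchIn v a) (punchIn v b)
    edge-delete ⊕ a b = refl
    edge-delete ⊖ a b = refl

    Adj-irrefl : ∀ {x} → ¬ Adj G x x
    Adj-irrefl {x} (inj₁ e) with trans (sym (pos-irr x)) e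
    ... | ()
    Adj-irrefl {x} (inj₂ e) with trans (sym (neg-irr x)) e
    ... | ()

    Adj⇒≢ : ∀ {x y} → Adj G x y → x ≢ y
    Adj⇒≢ a refl = Adj-irrefl a

    triangle : ∀ a b {u₁ u₂} → u₁ ≢ u₂ → HasEdge G a u₁ v → HasEdge G b v u₂ → HasEdge G (a · b) u₁ u₂
    triangle ⊕ ⊕ u₁≢u₂ e₁ e₂ = condA _ _ u₁≢u₂ (inj₁ (e₁ , trans (pos-sym _ v) e₂))
    triangle ⊖ ⊖ u₁≢u₂ e₁ e₂ = condA _ _ u₁≢u₂ (inj₂ (e₁ , trans (neg-sym _ v) e₂))
    triangle ⊕ ⊖ u₁≢u₂ e₁ e₂ = condB _ _ u₁≢u₂ e₁ (trans (neg-sym _ v) e₂)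
    triangle ⊖ ⊕ u₁≢u₂ e₁ e₂ = trans (neg-sym _ _) (condB _ _ (u₁≢u₂ ∘ sym) (trans (pos-sym _ v) e₂) e₁)

    Adj⇒edge : ∀ {x y} → Adj G x y → ∃ λ s → HasEdge G s x y
    Adj⇒edge (inj₁ e) = ⊕ , e
    Adj⇒edge (inj₂ e) = ⊖ , e

    Adj-through-v : ∀ {x y} → x ≢ y → Adj G x v → Adj G v y → Adj G x y
    Adj-through-v x≢y xv vy with Adj⇒edge xv | Adj⇒edge vy
    ... | a , e₁ | b , e₂ = WG.edge⇒Adj (a · b) (triangle a b x≢y e₁ e₂)

    v≢neighbour : ∀ s {u} → HasEdge G s v u → v ≢ u
    v≢neighbour s e refl = Adj-irrefl (WG.edge⇒Adj s e)

    -- Walks of F are walks of G; conversely a walk of G between vertices other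
    -- than v can avoid v, since the two neighbours of v on it are adjacent.
    lift-walk : ∀ {a b} → Reach F a b → Reach G (punchIn v a) (punchIn v b)
    lift-walk = gmap (punchIn v) (λ r → r)

    private
      lower-Adj : ∀ {x y} (v≢x : v ≢ x) (v≢y : v ≢ y) → Adj G x y → Adj F (punchOut v≢x) (punchOut v≢y)
      lower-Adj v≢x v≢y = subst₂ (Adj G) (sym (punchIn-punchOut v≢x)) (sym (punchIn-punchOut v≢y))

    lower-walk : ∀ x y (v≢x : v ≢ x) (v≢y : v ≢ y) → Reach G x y → Reach F (punchOut v≢x) (punchOut v≢y)
    lower-walk x y v≢x v≢y ε = subst (Reach F (punchOut v≢x)) (punchOut-cong v refl) ε
    lower-walk x y v≢x v≢y (_◅_ {j = w} r p) with v Fin.≟ w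
    ... | no v≢w = lower-Adj v≢x v≢w r ◅ lower-walk w y v≢w v≢y p
    lower-walk x y v≢x v≢y (r ◅ ε) | yes refl = ⊥-elim (v≢y refl)
    lower-walk x y v≢x v≢y (_◅_ r (_◅_ {j = w₂} r₂ p)) | yes refl with x Fin.≟ w₂
    ... | yes refl = subst (λ z → Reach F z (punchOut v≢y)) (punchOut-cong v refl) (lower-walk x y (Adj⇒≢ r₂) v≢y p)
    ... | no x≢w₂  = lower-Adj v≢x v≢w₂ (Adj-through-v x≢w₂ r r₂) ◅ lower-walk w₂ y v≢w₂ v≢y p
      where
      v≢w₂ : v ≢ w₂
      v≢w₂ = Adj⇒≢ r₂

    lower-walk′ : ∀ a b → Reach G (punchIn v a) (punchIn v b) → Reach F a b
    lower-walk′ a b p = subst₂ (Reach F) (punchOut-punchIn v) (punchOut-punchIn v)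
                          (lower-walk _ _ (punchInᵢ≢i v a ∘ sym) (punchInᵢ≢i v b ∘ sym) p)

    lift-cycle : Cycle F → Cycle G
    lift-cycle C = record
      { m = m C ; vtx = punchIn v ∘ vtx C ; inj = inj C ∘ punchIn-injective v _ _
      ; sgn = sgn C ; edge = λ i → trans (sym (edge-delete (sgn C i) _ _)) (edge C i) }

    module AvoidingV (C : Cycle G) (avoids : ∀ i → v ≢ vtx C i) where
      lowered : Fin (len C) → Fin n
      lowered i = punchOut (avoids i)

      lowered-vertex : ∀ i → punchIn v (lowered i) ≡ vtx C i
      lowered-vertex i = punchIn-punchOut (avoids i)

      lower-cycle : Cycle F
      lower-cycle = record
        { m = m C ; vtx = lowered ; inj = λ {x} {y} e → inj C (punchOut-injective (avoids x) (avoids y) e)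
        ; sgn = sgn C
        ; edge = λ i → trans (edge-delete (sgn C i) _ _)
                             (subst₂ (HasEdge G (sgn C i)) (sym (lowered-vertex i)) (sym (lowered-vertex (nextPos i))) (edge C i)) }

    -- A cycle of G of length ≥ 4 through v = vt P can be shortcut at v: removing v
    -- and joining its two neighbours on the cycle by the edge given by `triangle`
    -- yields a cycle of F of the same parity.
    module Shortcut (M : ℕ) (vt : Fin (4 + M) → Fin (suc n)) (vt-inj : Injective _≡_ _≡_ vt) (sg : Fin (4 + M) → Sign)
                    (ed : ∀ i → HasEdge G (sg i) (vt i) (vt (nextPos i))) (P : Fin (4 + M)) (vt-P : vt P ≡ v) where

      C : Cycle G
      C = record { m = suc M ; vtx = vt ; inj = vt-inj ; sgn = sg ; edge = ed }

      at : Fin (3 + M) → Fin (4 + M)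
      at = punchIn P

      v≢vt-at : ∀ k → v ≢ vt (at k)
      v≢vt-at k e = punchInᵢ≢i P k (vt-inj (trans (sym e) (sym vt-P)))

      sign : ∀ k → AfterRemoval P k → Sign
      sign k (consecutive _) = sg (at k)
      sign k (around _ _)    = sg (at k) · sg P

      sg′ : Fin (3 + M) → Sign
      sg′ k = sign k (after-removal P k)

      edge-in-G : ∀ k (r : AfterRemoval P k) → HasEdge G (sign k r) (vt (at k)) (vt (at (nextPos k)))
      edge-in-G k (consecutive e) = subst (HasEdge G (sg (at k)) (vt (at k)) ∘ vt) e (ed (at k))
      edge-in-G k (around e₁ e₂)  = triangle (sg (at k)) (sg P) (λ e → nextPos-≢ k (sym (punchIn-injective P _ _ (vt-inj e))))
        (subst (HasEdge G (sg (at k)) (vt (at k))) (trans (cong vt e₁) vt-P) (ed (at k)))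
        (subst₂ (HasEdge G (sg P)) vt-P (cong vt e₂) (ed P))

      C′ : Cycle F
      C′ = record
        { m = M ; vtx = λ k → punchOut (v≢vt-at k)
        ; inj = λ {x} {y} e → punchIn-injective P x y (vt-inj (trans (sym (punchIn-punchOut (v≢vt-at x)))
                                (trans (cong (punchIn v) e) (punchIn-punchOut (v≢vt-at y)))))
        ; sgn = sg′
        ; edge = λ k → trans (edge-delete (sg′ k) _ _)
                         (subst₂ (HasEdge G (sg′ k)) (sym (punchIn-punchOut (v≢vt-at k))) (sym (punchIn-punchOut (v≢vt-at (nextPos k))))
                                 (edge-in-G k (after-removal P k))) }

      -- Only the edge leaving the predecessor Q of P changes sign.
      Q : Fin (4 + M)
      Q = proj₁ (predecessor P)
      Q⁺≡P : nextPos Q ≡ P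
      Q⁺≡P = proj₂ (predecessor P)

      P≢Q : P ≢ Q
      P≢Q P≡Q = nextPos-≢ P (trans (cong nextPos P≡Q) Q⁺≡P)

      K₀ : Fin (3 + M)
      K₀ = punchOut P≢Q

      at-K₀ : at K₀ ≡ Q
      at-K₀ = punchIn-punchOut P≢Q

      sg′-K₀ : sg′ K₀ ≡ sg Q · sg P
      sg′-K₀ with after-removal P K₀
      ... | consecutive e = ⊥-elim (punchInᵢ≢i P _ (sym (trans (sym Q⁺≡P) (trans (cong nextPos (sym at-K₀)) e))))
      ... | around _ _    = cong (λ z → sg z · sg P) at-K₀

      sg′-other : ∀ k → k ≢ K₀ → sg′ k ≡ sg (at k)
      sg′-other k k≢K₀ with after-removal P k
      ... | consecutive _ = refl
      ... | around e₁ _   = ⊥-elim (k≢K₀ (punchIn-injective P k K₀ (trans (nextPos-injective (at k) Q (trans e₁ (sym Q⁺≡P))) (sym at-K₀))))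

      open NegativeEdges C using (negAt)
      open NegativeEdges C′ using () renaming (negAt to negAt′)

      -- dropping the edges at Q and P and adding the shortcut edge
      negs-shortcut : negs C′ + (negAt Q + negAt P) ≡ negs C + bit (isNeg (sg Q · sg P))
      negs-shortcut = begin
        negs C′ + (negAt Q + negAt P)                          ≡⟨ cong (λ s → s + (negAt Q + negAt P)) (NegativeEdges.negs-sum C′) ⟩
        sum negAt′ + (negAt Q + negAt P)                       ≡⟨ sym (ℕ.+-assoc (sum negAt′) (negAt Q) (negAt P)) ⟩
        sum negAt′ + negAt Q + negAt P                         ≡⟨ cong (λ q → sum negAt′ + negAt q + negAt P) (sym at-K₀) ⟩
        sum negAt′ + negAt (at K₀) + negAt P                   ≡⟨ cong (_+ negAt P) (sum-update negAt′ (negAt ∘ at) K₀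
                                                                     (λ k k≢K₀ → cong (bit ∘ isNeg) (sg′-other k k≢K₀))) ⟩
        sum (negAt ∘ at) + negAt′ K₀ + negAt P                  ≡⟨ cong (λ s → sum (negAt ∘ at) + bit (isNeg s) + negAt P) sg′-K₀ ⟩
        sum (negAt ∘ at) + bs + negAt P                        ≡⟨ rearrange (sum (negAt ∘ at)) bs (negAt P) ⟩
        (negAt P + sum (negAt ∘ at)) + bs                      ≡⟨ cong (_+ bs) (sym (trans (NegativeEdges.negs-sum C) (sum-remove {i = P} negAt))) ⟩
        negs C + bs                                            ∎
        where
        open ≡-Reasoning
        bs = bit (isNeg (sg Q · sg P))
        rearrange : ∀ a b c → a + b + c ≡ c + a + b
        rearrange = solve-∀

      -- the shortcut edge closes a balanced triangle, so parities agree
      parity : EvenN (negs C′) → EvenN (negs C)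
      parity even′ = even-transfer (negs C′) (negAt Q + negAt P) (negs C) _ negs-shortcut even′ (·-balanced (sg Q) (sg P))

module Contraction where

  open import Defs
  open SimplicialVertices
  open import Data.Bool using (true; false; not; _∧_; _∨_)
  open import Data.Nat using (suc)
  open import Data.Fin as Fin using (Fin)
  open import Data.Product using (_×_; _,_)
  open import Data.Sum using (inj₁; inj₂)
  open import Relation.Binary.PropositionalEquality using (_≡_; _≢_; refl; trans; subst)
  open import Relation.Nullary using (yes; no)

  private
    ==⇒≡ : ∀ {n} {x y : Fin n} → (x == y) ≡ true → x ≡ y
    ==⇒≡ {x = x} {y} p with x Fin.≟ y
    ... | yes x≡y = x≡y

    not-==⇒≢ : ∀ {n} {x y : Fin n} → not (x == y) ≡ true → x ≢ y
    not-==⇒≢ {x = x} {y} p with x Fin.≟ y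
    ... | no x≢y = x≢y

    ∧-left : ∀ {a b} → (a ∧ b) ≡ true → a ≡ true
    ∧-left {true} _ = refl
    ∧-right : ∀ {a b} → (a ∧ b) ≡ true → b ≡ true
    ∧-right {true} p = p

    ∨-absorb : ∀ b c → (c ≡ true → b ≡ true) → (b ∨ c) ≡ b
    ∨-absorb true  c     _ = refl
    ∨-absorb false false _ = refl
    ∨-absorb false true  h with h refl
    ... | ()

    ∨-absorb₂ : ∀ b c d → (c ≡ true → b ≡ true) → (d ≡ true → b ≡ true) → (b ∨ c ∨ d) ≡ b
    ∨-absorb₂ b c d hc hd = ∨-absorb b (c ∨ d) (λ cd → either c d cd hc hd)
      where
      either : ∀ c d → (c ∨ d) ≡ true → (c ≡ true → b ≡ true) → (d ≡ true → b ≡ true) → b ≡ true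
      either true  d _  hc _  = hc refl
      either false d cd _  hd = hd cd

  -- When contracting an edge of sign s, an edge of sign `relabel s t` towards v
  -- becomes an edge of sign t towards w (this mirrors the definition of contract).
  relabel : Sign → Sign → Sign
  relabel ⊕ t = t
  relabel ⊖ t = flip t

  relabel-· : ∀ s t → relabel s t · s ≡ t
  relabel-· ⊕ ⊕ = refl
  relabel-· ⊕ ⊖ = refl
  relabel-· ⊖ ⊕ = refl
  relabel-· ⊖ ⊖ = refl

  module ContractionOfSimplicial {n} (G : SG (suc n)) (v : Fin (suc n)) (S : Simple G) (ss : SignedSimplicial G v) where
    open Simple S
    open SignedSimplicial ss
    open SimplicialVertex G v S ss

    module _ (w : Fin (suc n)) (s : Sign) (vw : HasEdge G s v w) where

      created-edge : ∀ t {x} → x ≢ w → HasEdge G (relabel s t) x v → HasEdge G t x w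
      created-edge t x≢w xv = subst (λ t′ → HasEdge G t′ _ w) (relabel-· s t) (triangle (relabel s t) s x≢w xv vw)

      created-disjunct : ∀ t x y → ((y == w) ∧ edgeB G (relabel s t) x v ∧ not (x == w)) ≡ true → HasEdge G t x y
      created-disjunct t x y p with ==⇒≡ {x = y} {w} (∧-left p)
      ... | refl = created-edge t (not-==⇒≢ (∧-right {edgeB G (relabel s t) x v} rest)) (∧-left rest)
        where rest = ∧-right {y == y} p

      contract-edges : ∀ t x y →
        (edgeB G t x y ∨ ((y == w) ∧ edgeB G (relabel s t) x v ∧ not (x == w))
                       ∨ ((x == w) ∧ edgeB G (relabel s t) y v ∧ not (y == w))) ≡ edgeB G t x y
      contract-edges t x y = ∨-absorb₂ _ _ _ (created-disjunct t x y)
                                             (λ p → trans (edge-sym t x y) (created-disjunct t y x p))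

      -- a loop is created at w only where the simplicial condition already forces one
      created-loop : ∀ x → ((x == w) ∧ (loop G v ∨ edgeB G (flip s) v w)) ≡ true → loop G x ≡ true
      created-loop x p with ==⇒≡ {x = x} (∧-left p)
      ... | refl with loop G v in loop-v
      ... | true  = condC w (inj₁ (Adj-w-v , loop-v))
        where Adj-w-v = WG.Adj-sym (WG.edge⇒Adj s vw)
      ... | false = condC w (inj₂ (both s vw (∧-right p)))
        where
        both : ∀ s → HasEdge G s v w → HasEdge G (flip s) v w → (pos G w v ≡ true × neg G w v ≡ true)
        both ⊕ e e′ = trans (pos-sym w v) e , trans (neg-sym w v) e′
        both ⊖ e e′ = trans (pos-sym w v) e′ , trans (neg-sym w v) e

    contraction : ∀ w s → HasEdge G s v w → contract G s v w ≈G delete G v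
    contraction w ⊕ vw = (λ a b → contract-edges w ⊕ vw ⊕ (pI a) (pI b)) , (λ a b → contract-edges w ⊕ vw ⊖ (pI a) (pI b))
                       , (λ a → ∨-absorb (loop G (pI a)) _ (created-loop w ⊕ vw (pI a)))
      where pI = Fin.punchIn v
    contraction w ⊖ vw = (λ a b → contract-edges w ⊖ vw ⊕ (pI a) (pI b)) , (λ a b → contract-edges w ⊖ vw ⊖ (pI a) (pI b))
                       , (λ a → ∨-absorb (loop G (pI a)) _ (created-loop w ⊖ vw (pI a)))
      where pI = Fin.punchIn v

module Colorings where

  open import Defs
  open FiniteSums
  open SimplicialVertices
  open import Data.Bool using (true; false; T; if_then_else_)
  open import Data.Nat as ℕ using (ℕ; zero; suc; _+_; _*_; _≤_; z≤n)
  import Data.Nat.Properties as ℕ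
  open import Data.Integer as ℤ using (ℤ; +_; -_; -[1+_]; +[1+_]; ∣_∣) renaming (_*_ to _*ℤ_)
  import Data.Integer.Properties as ℤ
  open import Data.Integer.Tactic.RingSolver using (solve-∀)
  open import Data.Fin as Fin using (Fin; punchIn; punchOut)
  open import Data.Fin.Properties using (punchIn-punchOut)
  open import Data.List using (List; []; _∷_; _++_; map; concatMap; filterᵇ; length; allFin; upTo)
  open import Data.List.Properties using (length-++; length-map; length-upTo)
  open import Data.List.Relation.Unary.All as All using (All; []; _∷_)
  open import Data.List.Relation.Unary.All.Properties using (concat⁺; map⁺)
  open import Data.List.Relation.Unary.Unique.Propositional using (Unique)
  import Data.List.Relation.Unary.Unique.Propositional.Properties as Unique
  import Data.List.Relation.Unary.AllPairs as AllPairs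
  open import Data.List.Membership.Propositional using (_∈_; _∉_)
  open import Data.List.Membership.Propositional.Properties
    using (∈-filter⁻; ∈-filter⁺; ∈-map⁻; ∈-map⁺; ∈-++⁻; ∈-++⁺ˡ; ∈-++⁺ʳ; ∈-allFin; ∈-upTo⁺; ∈-upTo⁻)
  open import Data.List.Relation.Unary.Any using (here)
  open import Data.Vec as Vec using (Vec; lookup; insertAt)
  open import Data.Vec.Properties using (insertAt-lookup; insertAt-punchIn)
  open import Data.Product using (_×_; _,_; proj₁; proj₂; ∃-syntax)
  open import Data.Sum using (inj₁; inj₂)
  open import Relation.Binary.PropositionalEquality using (_≡_; _≢_; refl; sym; trans; cong; cong₂; subst; subst₂; module ≡-Reasoning)
  open import Relation.Nullary using (yes; no)
  open import Relation.Nullary.Decidable using (T?)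
  open import Data.Empty using (⊥)
  open import Function using (_∘_)

  Bounded : ℕ → ℤ → Set
  Bounded k z = ∣ z ∣ ≤ k

  Λ-bounded : ∀ k → All (Bounded k) (Λ k)
  Λ-bounded k = z≤n ∷ pairs (upTo k) (All.tabulate ∈-upTo⁻)
    where
    pairs : ∀ L → All (λ i → suc i ≤ k) L → All (Bounded k) (concatMap (λ i → + suc i ∷ - (+ suc i) ∷ []) L)
    pairs []      []       = []
    pairs (i ∷ L) (p ∷ ps) = p ∷ p ∷ pairs L ps

  Λ-size : ∀ k → length (Λ k) ≡ 2 * k + 1
  Λ-size k = begin
    length (Λ k)                                  ≡⟨ sym (Σ-one (Λ k)) ⟩
    1 + Σ (λ _ → 1) (concatMap ±suc (upTo k))     ≡⟨ cong suc (Σ-concatMap (λ _ → 1) ±suc (upTo k)) ⟩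
    1 + Σ (λ _ → 1 * 2) (upTo k)                  ≡⟨ cong suc (Σ-*ʳ (λ _ → 1) 2 (upTo k)) ⟩
    1 + Σ (λ _ → 1) (upTo k) * 2                  ≡⟨ cong (λ l → 1 + l * 2) (trans (Σ-one (upTo k)) (length-upTo k)) ⟩
    1 + k * 2                                     ≡⟨ cong suc (ℕ.*-comm k 2) ⟩
    1 + 2 * k                                     ≡⟨ ℕ.+-comm 1 (2 * k) ⟩
    2 * k + 1                                     ∎
    where
    open ≡-Reasoning
    ±suc : ℕ → List ℤ
    ±suc i = + suc i ∷ - (+ suc i) ∷ []

  module ℤCount = Count ℤ._≟_
  module ℕCount = Count ℕ._≟_

  Λ-once : ∀ k z → Bounded k z → Σ (λ y → ind (y ℤ.≟ z)) (Λ k) ≡ 1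
  Λ-once k z bz = trans (cong (λ s → ind (+ 0 ℤ.≟ z) + s) (Σ-concatMap (λ y → ind (y ℤ.≟ z)) ±suc (upTo k)))
                        (by-sign z bz)
    where
    ±suc : ℕ → List ℤ
    ±suc i = + suc i ∷ - (+ suc i) ∷ []
    pair : ℤ → ℕ → ℕ
    pair z i = ind (+ suc i ℤ.≟ z) + (ind (-[1+ i ] ℤ.≟ z) + 0)
    pair-pos : ∀ j i → pair +[1+ j ] i ≡ ind (i ℕ.≟ j)
    pair-pos j i = trans (cong (λ s → ind (+ suc i ℤ.≟ +[1+ j ]) + (s + 0)) (ind-no (-[1+ i ] ℤ.≟ +[1+ j ]) (λ ())))
                         (trans (ℕ.+-identityʳ _) (ind-iff (+ suc i ℤ.≟ +[1+ j ]) (i ℕ.≟ j) (λ { refl → refl }) (λ { refl → refl })))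
    pair-neg : ∀ j i → pair -[1+ j ] i ≡ ind (i ℕ.≟ j)
    pair-neg j i = trans (cong (λ s → s + (ind (-[1+ i ] ℤ.≟ -[1+ j ]) + 0)) (ind-no (+ suc i ℤ.≟ -[1+ j ]) (λ ())))
                         (trans (ℕ.+-identityʳ _) (ind-iff (-[1+ i ] ℤ.≟ -[1+ j ]) (i ℕ.≟ j) (λ { refl → refl }) (λ { refl → refl })))
    pair-zero : ∀ i → pair (+ 0) i ≡ 0
    pair-zero i = cong₂ _+_ (ind-no (+ suc i ℤ.≟ + 0) (λ ())) (cong (_+ 0) (ind-no (-[1+ i ] ℤ.≟ + 0) (λ ())))
    by-sign : ∀ z → Bounded k z → ind (+ 0 ℤ.≟ z) + Σ (pair z) (upTo k) ≡ 1
    by-sign (+ zero) _  = cong suc (trans (Σ-cong (upTo k) pair-zero) (Σ-zero (upTo k)))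
    by-sign +[1+ j ] bj = trans (Σ-cong (upTo k) (pair-pos j)) (ℕCount.occurs-once j (upTo k) (Unique.upTo⁺ k) (∈-upTo⁺ bj))
    by-sign -[1+ j ] bj = trans (Σ-cong (upTo k) (pair-neg j)) (ℕCount.occurs-once j (upTo k) (Unique.upTo⁺ k) (∈-upTo⁺ bj))

  module _ {A : Set} (xs : List A) where
    allVecs-insertAt : ∀ n (v : Fin (suc n)) (f : Vec A (suc n) → ℕ) →
      Σ f (allVecs xs (suc n)) ≡ Σ (λ γ → Σ (λ x → f (insertAt γ v x)) xs) (allVecs xs n)
    allVecs-insertAt n Fin.zero f =
      trans (Σ-concatMap f (λ x → map (x Vec.∷_) (allVecs xs n)) xs)
     (trans (Σ-cong xs (λ x → Σ-map f (x Vec.∷_) (allVecs xs n)))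
            (Σ-swap (λ x γ → f (x Vec.∷ γ)) xs (allVecs xs n)))
    allVecs-insertAt (suc m) (Fin.suc v) f =
      trans (Σ-concatMap f (λ x → map (x Vec.∷_) (allVecs xs (suc m))) xs)
     (trans (Σ-cong xs (λ y → trans (Σ-map f (y Vec.∷_) (allVecs xs (suc m))) (allVecs-insertAt m v (λ δ → f (y Vec.∷ δ)))))
     (sym (trans (Σ-concatMap g (λ x → map (x Vec.∷_) (allVecs xs m)) xs)
                 (Σ-cong xs (λ y → Σ-map g (y Vec.∷_) (allVecs xs m))))))
      where g = λ γ → Σ (λ x → f (insertAt γ (Fin.suc v) x)) xs

    allVecs-entries : ∀ {P : A → Set} → All P xs → ∀ n → All (λ γ → ∀ i → P (lookup γ i)) (allVecs xs n)
    allVecs-entries ps zero    = (λ ()) ∷ []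
    allVecs-entries {P} ps (suc n) = concat⁺ (per-head xs ps)
      where
      per-head : ∀ ys → All P ys → All (All (λ γ → ∀ i → P (lookup γ i))) (map (λ x → map (x Vec.∷_) (allVecs xs n)) ys)
      per-head []       []        = []
      per-head (y ∷ ys) (p ∷ ps′) = map⁺ (All.map (λ {γ} h → λ { Fin.zero → p ; (Fin.suc i) → h i }) (allVecs-entries ps n)) ∷ per-head ys ps′

  neg-self⇒0 : ∀ z → z ≡ - z → z ≡ + 0
  neg-self⇒0 (+ zero)  _ = refl
  neg-self⇒0 +[1+ n ] ()
  neg-self⇒0 -[1+ n ] ()

  module ColoringsOfSimplicial {n} (G : SG (suc n)) (v : Fin (suc n)) (S : Simple G) (ss : SignedSimplicial G v) (k : ℕ) where
    open Simple S
    open SignedSimplicial ss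
    open SimplicialVertex G v S ss

    off-v : ∀ i → i ≢ v → ∃[ a ] punchIn v a ≡ i
    off-v i i≢v = punchOut (i≢v ∘ sym) , punchIn-punchOut (i≢v ∘ sym)

    module Extension (γ : Vec ℤ n) where
      ext : ℤ → Fin (suc n) → ℤ
      ext x u = lookup (insertAt γ v x) u

      c : Fin (suc n) → ℤ
      c = ext (+ 0)

      ext-off-v : ∀ x u → u ≢ v → ext x u ≡ c u
      ext-off-v x u u≢v with off-v u u≢v
      ... | a , refl = trans (insertAt-punchIn γ v x a) (sym (insertAt-punchIn γ v (+ 0) a))

      ext-v : ∀ x → ext x v ≡ x
      ext-v x = insertAt-lookup γ v x

      c-punchIn : ∀ a → c (punchIn v a) ≡ lookup γ a
      c-punchIn a = insertAt-punchIn γ v (+ 0) a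

      pos-nbrs neg-nbrs : List (Fin (suc n))
      pos-nbrs = filterᵇ (pos G v) (allFin (suc n))
      neg-nbrs = filterᵇ (neg G v) (allFin (suc n))

      loop-colours : List ℤ
      loop-colours = if loop G v then + 0 ∷ [] else []

      forbidden : List ℤ
      forbidden = map c pos-nbrs ++ map (λ u → - c u) neg-nbrs ++ loop-colours

      pos-nbrs⁻ : ∀ {u} → u ∈ pos-nbrs → pos G v u ≡ true
      pos-nbrs⁻ m = T-≡ (proj₂ (∈-filter⁻ (T? ∘ pos G v) m))
        where
        T-≡ : ∀ {b} → T b → b ≡ true
        T-≡ {true} _ = refl
      neg-nbrs⁻ : ∀ {u} → u ∈ neg-nbrs → neg G v u ≡ true
      neg-nbrs⁻ m = T-≡ (proj₂ (∈-filter⁻ (T? ∘ neg G v) m))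
        where
        T-≡ : ∀ {b} → T b → b ≡ true
        T-≡ {true} _ = refl
      pos-nbrs⁺ : ∀ {u} → pos G v u ≡ true → u ∈ pos-nbrs
      pos-nbrs⁺ {u} e = ∈-filter⁺ (T? ∘ pos G v) (∈-allFin u) (subst T (sym e) _)
      neg-nbrs⁺ : ∀ {u} → neg G v u ≡ true → u ∈ neg-nbrs
      neg-nbrs⁺ {u} e = ∈-filter⁺ (T? ∘ neg G v) (∈-allFin u) (subst T (sym e) _)

      loop-colours⁻ : ∀ {z} → z ∈ loop-colours → loop G v ≡ true × z ≡ + 0
      loop-colours⁻ {z} m with loop G v
      loop-colours⁻ {z} (here refl) | true = refl , refl
      loop-colours⁺ : loop G v ≡ true → + 0 ∈ loop-colours
      loop-colours⁺ e rewrite e = here refl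

      data Forbidden (x : ℤ) : Set where
        by-pos  : ∀ u → pos G v u ≡ true → x ≡ c u → Forbidden x
        by-neg  : ∀ u → neg G v u ≡ true → x ≡ - c u → Forbidden x
        by-loop : loop G v ≡ true → x ≡ + 0 → Forbidden x

      forbidden⁻ : ∀ {x} → x ∈ forbidden → Forbidden x
      forbidden⁻ m with ∈-++⁻ (map c pos-nbrs) m
      ... | inj₁ m₁ with ∈-map⁻ c m₁
      ...   | u , u∈ , e = by-pos u (pos-nbrs⁻ u∈) e
      forbidden⁻ m | inj₂ m₂ with ∈-++⁻ (map (λ u → - c u) neg-nbrs) m₂
      ... | inj₁ m₁ with ∈-map⁻ (λ u → - c u) m₁
      ...   | u , u∈ , e = by-neg u (neg-nbrs⁻ u∈) e
      forbidden⁻ m | inj₂ m₂ | inj₂ m₃ with loop-colours⁻ m₃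
      ... | l , e = by-loop l e

      forbidden⁺ : ∀ {x} → Forbidden x → x ∈ forbidden
      forbidden⁺ (by-pos u e refl) = ∈-++⁺ˡ (∈-map⁺ c (pos-nbrs⁺ e))
      forbidden⁺ (by-neg u e refl) = ∈-++⁺ʳ (map c pos-nbrs) (∈-++⁺ˡ (∈-map⁺ (λ u → - c u) (neg-nbrs⁺ e)))
      forbidden⁺ (by-loop l refl)  = ∈-++⁺ʳ (map c pos-nbrs) (∈-++⁺ʳ (map (λ u → - c u) neg-nbrs) (loop-colours⁺ l))

      forbidden-length : length forbidden ≡ degree G v
      forbidden-length =
        trans (length-++ (map c pos-nbrs))
       (trans (cong₂ _+_ (length-map c pos-nbrs) (trans (length-++ (map (λ u → - c u) neg-nbrs))
                                                      (cong₂ _+_ (length-map _ neg-nbrs) loops)))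
              (sym (ℕ.+-assoc (length pos-nbrs) (length neg-nbrs) _)))
        where
        loops : length loop-colours ≡ (if loop G v then 1 else 0)
        loops with loop G v
        ... | true  = refl
        ... | false = refl

      restrict : ∀ x → Proper G (ext x) → Proper F (lookup γ)
      restrict x (pp , pn , pl) =
          (λ a b e → subst₂ _≢_ (insertAt-punchIn γ v x a) (insertAt-punchIn γ v x b) (pp _ _ e))
        , (λ a b e → subst₂ (λ p q → p ≢ - q) (insertAt-punchIn γ v x a) (insertAt-punchIn γ v x b) (pn _ _ e))
        , (λ a e → subst (_≢ + 0) (insertAt-punchIn γ v x a) (pl _ e))

      proper⇒allowed : ∀ x → Proper G (ext x) → x ∉ forbidden
      proper⇒allowed x (pp , pn , pl) m with forbidden⁻ m
      ... | by-pos u e refl = pp v u e (trans (ext-v x) (sym (ext-off-v x u (v≢neighbour ⊕ e ∘ sym))))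
      ... | by-neg u e refl = pn v u e (trans (ext-v x) (cong -_ (sym (ext-off-v x u (v≢neighbour ⊖ e ∘ sym)))))
      ... | by-loop l refl  = pl v l (ext-v x)

      module _ (PF : Proper F (lookup γ)) where
        c-pos : ∀ i j → i ≢ v → j ≢ v → pos G i j ≡ true → c i ≢ c j
        c-pos i j i≢v j≢v e with off-v i i≢v | off-v j j≢v
        ... | a , refl | b , refl = subst₂ _≢_ (sym (c-punchIn a)) (sym (c-punchIn b)) (proj₁ PF a b e)
        c-neg : ∀ i j → i ≢ v → j ≢ v → neg G i j ≡ true → c i ≢ - c j
        c-neg i j i≢v j≢v e with off-v i i≢v | off-v j j≢v
        ... | a , refl | b , refl = subst₂ (λ p q → p ≢ - q) (sym (c-punchIn a)) (sym (c-punchIn b)) (proj₁ (proj₂ PF) a b e)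
        c-loop : ∀ i → i ≢ v → loop G i ≡ true → c i ≢ + 0
        c-loop i i≢v e with off-v i i≢v
        ... | a , refl = subst (_≢ + 0) (sym (c-punchIn a)) (proj₂ (proj₂ PF) a e)

        allowed⇒proper : ∀ x → x ∉ forbidden → Proper G (ext x)
        allowed⇒proper x x∉ = pp , pn , pl
          where
          pp : ∀ i j → pos G i j ≡ true → ext x i ≢ ext x j
          pp i j e eq with i Fin.≟ v | j Fin.≟ v
          ... | yes refl | yes refl = v≢neighbour ⊕ e refl
          ... | yes refl | no j≢v = x∉ (forbidden⁺ (by-pos j e (trans (sym (ext-v x)) (trans eq (ext-off-v x j j≢v)))))
          ... | no i≢v | yes refl = x∉ (forbidden⁺ (by-pos i (trans (pos-sym v i) e) (trans (sym (ext-v x)) (trans (sym eq) (ext-off-v x i i≢v)))))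
          ... | no i≢v | no j≢v = c-pos i j i≢v j≢v e (trans (sym (ext-off-v x i i≢v)) (trans eq (ext-off-v x j j≢v)))
          pn : ∀ i j → neg G i j ≡ true → ext x i ≢ - ext x j
          pn i j e eq with i Fin.≟ v | j Fin.≟ v
          ... | yes refl | yes refl = v≢neighbour ⊖ e refl
          ... | yes refl | no j≢v = x∉ (forbidden⁺ (by-neg j e (trans (sym (ext-v x)) (trans eq (cong -_ (ext-off-v x j j≢v))))))
          ... | no i≢v | yes refl = x∉ (forbidden⁺ (by-neg i (trans (neg-sym v i) e) x≡))
            where
            x≡ : x ≡ - c i
            x≡ = trans (sym (ℤ.neg-involutive x)) (cong -_ (trans (sym (cong -_ (ext-v x))) (trans (sym eq) (ext-off-v x i i≢v))))
          ... | no i≢v | no j≢v = c-neg i j i≢v j≢v e (trans (sym (ext-off-v x i i≢v)) (trans eq (cong -_ (ext-off-v x j j≢v))))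
          pl : ∀ i → loop G i ≡ true → ext x i ≢ + 0
          pl i e eq with i Fin.≟ v
          ... | yes refl = x∉ (forbidden⁺ (by-loop e (trans (sym (ext-v x)) eq)))
          ... | no i≢v   = c-loop i i≢v e (trans (sym (ext-off-v x i i≢v)) eq)

        -- The forbidden colours are pairwise distinct: this is where the simplicial
        -- condition enters.
        loop-neighbour : ∀ u → Adj G v u → loop G v ≡ true → c u ≢ + 0
        loop-neighbour u a l = c-loop u (Adj⇒≢ a ∘ sym) (condC u (inj₁ (WG.Adj-sym a , l)))

        forbidden-unique : Unique forbidden
        forbidden-unique = Unique.++⁺ unique-pos (Unique.++⁺ unique-neg (unique-loop (loop G v)) (λ (m₁ , m₂) → neg-vs-loop m₁ m₂))
                                      (λ (m₁ , m₂) → pos-vs-rest m₁ m₂)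
          where
          unique-pos : Unique (map c pos-nbrs)
          unique-pos = Unique-map c pos-nbrs (Unique.filter⁺ (T? ∘ pos G v) (Unique.allFin⁺ (suc n)))
            (λ a b ma mb a≢b → c-pos a b (v≢neighbour ⊕ (pos-nbrs⁻ ma) ∘ sym) (v≢neighbour ⊕ (pos-nbrs⁻ mb) ∘ sym)
               (condA a b a≢b (inj₁ (trans (pos-sym a v) (pos-nbrs⁻ ma) , trans (pos-sym b v) (pos-nbrs⁻ mb)))))
          unique-neg : Unique (map (λ u → - c u) neg-nbrs)
          unique-neg = Unique-map (λ u → - c u) neg-nbrs (Unique.filter⁺ (T? ∘ neg G v) (Unique.allFin⁺ (suc n)))
            (λ a b ma mb a≢b eq → c-pos a b (v≢neighbour ⊖ (neg-nbrs⁻ ma) ∘ sym) (v≢neighbour ⊖ (neg-nbrs⁻ mb) ∘ sym)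
               (condA a b a≢b (inj₂ (trans (neg-sym a v) (neg-nbrs⁻ ma) , trans (neg-sym b v) (neg-nbrs⁻ mb))))
               (ℤ.neg-injective eq))
          unique-loop : ∀ b → Unique (if b then + 0 ∷ [] else [])
          unique-loop true  = [] AllPairs.∷ AllPairs.[]
          unique-loop false = AllPairs.[]
          neg-vs-loop : ∀ {z} → z ∈ map (λ u → - c u) neg-nbrs → z ∈ loop-colours → ⊥
          neg-vs-loop m₁ m₂ with ∈-map⁻ (λ u → - c u) m₁ | loop-colours⁻ m₂
          ... | u , u∈ , refl | l , eq =
            loop-neighbour u (inj₂ (neg-nbrs⁻ u∈)) l (trans (sym (ℤ.neg-involutive (c u))) (cong -_ eq))
          pos-vs-rest : ∀ {z} → z ∈ map c pos-nbrs → z ∈ (map (λ u → - c u) neg-nbrs ++ loop-colours) → ⊥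
          pos-vs-rest m₁ m₂ with ∈-map⁻ c m₁ | ∈-++⁻ (map (λ u → - c u) neg-nbrs) m₂
          ... | u , u∈ , refl | inj₂ m₃ with loop-colours⁻ m₃
          ...   | l , eq = loop-neighbour u (inj₁ (pos-nbrs⁻ u∈)) l eq
          pos-vs-rest m₁ m₂ | u , u∈ , refl | inj₁ m₃ with ∈-map⁻ (λ u → - c u) m₃
          ...   | w , w∈ , eq with u Fin.≟ w
          ...     | yes refl = c-loop u (v≢neighbour ⊕ (pos-nbrs⁻ u∈) ∘ sym)
                                 (condC u (inj₂ (trans (pos-sym u v) (pos-nbrs⁻ u∈) , trans (neg-sym u v) (neg-nbrs⁻ w∈))))
                                 (neg-self⇒0 (c u) eq)
          ...     | no u≢w = c-neg u w (v≢neighbour ⊕ (pos-nbrs⁻ u∈) ∘ sym) (v≢neighbour ⊖ (neg-nbrs⁻ w∈) ∘ sym)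
                                 (condB u w u≢w (trans (pos-sym u v) (pos-nbrs⁻ u∈)) (trans (neg-sym w v) (neg-nbrs⁻ w∈))) eq

        forbidden-bounded : (∀ i → Bounded k (lookup γ i)) → All (Bounded k) forbidden
        forbidden-bounded bγ = All.tabulate (λ m → bounded (forbidden⁻ m))
          where
          bc : ∀ u → Bounded k (c u)
          bc u with u Fin.≟ v
          ... | yes refl = subst (Bounded k) (sym (ext-v (+ 0))) z≤n
          ... | no u≢v with off-v u u≢v
          ...   | a , refl = subst (Bounded k) (sym (c-punchIn a)) (bγ a)
          bounded : ∀ {x} → Forbidden x → Bounded k x
          bounded (by-pos u _ refl) = bc u
          bounded (by-neg u _ refl) = subst (_≤ k) (sym (ℤ.∣-i∣≡∣i∣ (c u))) (bc u)
          bounded (by-loop _ refl)  = z≤n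

        count-extensions : (∀ i → Bounded k (lookup γ i)) →
                           Σ (λ x → ind (proper? G (insertAt γ v x))) (Λ k) + degree G v ≡ 2 * k + 1
        count-extensions bγ = begin
          Σ proper-ext (Λ k) + degree G v
            ≡⟨ cong (λ d → Σ proper-ext (Λ k) + d) (sym forbidden-length) ⟩
          Σ proper-ext (Λ k) + length forbidden
            ≡⟨ cong (λ d → Σ proper-ext (Λ k) + d) (sym (ℤCount.count-members (Λ k) forbidden forbidden-unique
                                                   (All.map (λ {z} bz → Λ-once k z bz) (forbidden-bounded bγ)))) ⟩
          Σ proper-ext (Λ k) + Σ (λ x → ind (x ∈? forbidden)) (Λ k)
            ≡⟨ sym (Σ-+ proper-ext (λ x → ind (x ∈? forbidden)) (Λ k)) ⟩
          Σ (λ x → proper-ext x + ind (x ∈? forbidden)) (Λ k)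
            ≡⟨ Σ-cong (Λ k) (λ x → ind-compl (proper? G (insertAt γ v x)) (x ∈? forbidden) (proper⇒allowed x) (allowed⇒proper x)) ⟩
          Σ (λ _ → 1) (Λ k)
            ≡⟨ trans (Σ-one (Λ k)) (Λ-size k) ⟩
          2 * k + 1 ∎
          where
          open ≡-Reasoning
          open import Data.List.Membership.DecPropositional ℤ._≟_ using (_∈?_)
          proper-ext : ℤ → ℕ
          proper-ext x = ind (proper? G (insertAt γ v x))

    open Extension

    extensions : ∀ (γ : Vec ℤ n) → (∀ i → Bounded k (lookup γ i)) →
                 Σ (λ x → ind (proper? G (insertAt γ v x))) (Λ k) + ind (proper? F γ) * degree G v ≡ ind (proper? F γ) * (2 * k + 1)
    extensions γ bγ with proper? F γ
    ... | yes PF = trans (cong (λ d → Σ (λ x → ind (proper? G (insertAt γ v x))) (Λ k) + d) (ℕ.*-identityˡ _))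
                         (trans (count-extensions γ PF bγ) (sym (ℕ.*-identityˡ _)))
    ... | no ¬PF = trans (ℕ.+-identityʳ _)
                         (trans (Σ-cong (Λ k) (λ x → ind-no (proper? G (insertAt γ v x)) (¬PF ∘ restrict γ x))) (Σ-zero (Λ k)))

    colorings-ℕ : numColorings G k + numColorings F k * degree G v ≡ numColorings F k * (2 * k + 1)
    colorings-ℕ = begin
      numColorings G k + numColorings F k * degree G v
        ≡⟨ cong₂ _+_ (trans (length-filter (proper? G) (allVecs (Λ k) (suc n))) (allVecs-insertAt (Λ k) n v (ind ∘ proper? G)))
                     (cong (_* degree G v) (length-filter (proper? F) Fcols)) ⟩
      Σ extG Fcols + Σ (ind ∘ proper? F) Fcols * degree G v
        ≡⟨ cong (λ d → Σ extG Fcols + d) (sym (Σ-*ʳ (ind ∘ proper? F) (degree G v) Fcols)) ⟩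
      Σ extG Fcols + Σ (λ γ → ind (proper? F γ) * degree G v) Fcols
        ≡⟨ sym (Σ-+ extG _ Fcols) ⟩
      Σ (λ γ → extG γ + ind (proper? F γ) * degree G v) Fcols
        ≡⟨ Σ-cong-All (allVecs-entries (Λ k) (Λ-bounded k) n) extensions ⟩
      Σ (λ γ → ind (proper? F γ) * (2 * k + 1)) Fcols
        ≡⟨ Σ-*ʳ (ind ∘ proper? F) (2 * k + 1) Fcols ⟩
      Σ (ind ∘ proper? F) Fcols * (2 * k + 1)
        ≡⟨ cong (_* (2 * k + 1)) (sym (length-filter (proper? F) Fcols)) ⟩
      numColorings F k * (2 * k + 1) ∎
      where
      open ≡-Reasoning
      Fcols = allVecs (Λ k) n
      extG : Vec ℤ n → ℕ
      extG γ = Σ (λ x → ind (proper? G (insertAt γ v x))) (Λ k)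

    chromatic-recursion : + numColorings G k ≡ (+ (2 * k + 1) ℤ.- + degree G v) *ℤ + numColorings F k
    chromatic-recursion = begin
      X                      ≡⟨ cancel X Cf D ⟩
      X ℤ.+ Cf *ℤ D ℤ.- Cf *ℤ D ≡⟨ cong (ℤ._- Cf *ℤ D) in-ℤ ⟩
      Cf *ℤ N ℤ.- Cf *ℤ D    ≡⟨ factor Cf N D ⟩
      (N ℤ.- D) *ℤ Cf        ∎
      where
      open ≡-Reasoning
      X = + numColorings G k
      Cf = + numColorings F k
      D = + degree G v
      N = + (2 * k + 1)
      cancel : ∀ (x c d : ℤ) → x ≡ x ℤ.+ c *ℤ d ℤ.- c *ℤ d
      cancel = solve-∀
      factor : ∀ (c t d : ℤ) → c *ℤ t ℤ.- c *ℤ d ≡ (t ℤ.- d) *ℤ c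
      factor = solve-∀
      in-ℤ : X ℤ.+ Cf *ℤ D ≡ Cf *ℤ N
      in-ℤ = trans (cong (ℤ._+_ X) (sym (ℤ.pos-* (numColorings F k) (degree G v))))
            (trans (sym (ℤ.pos-+ (numColorings G k) _))
            (trans (cong +_ colorings-ℕ) (ℤ.pos-* (numColorings F k) (2 * k + 1))))

module BalancedChordality where

  open import Defs
  open Parity
  open CyclePositions
  open CycleSums using (module NegativeEdges)
  open SimplicialVertices
  open import Data.Nat as ℕ using (ℕ; suc; _+_; _∸_; _≤_; _<_; s≤s; z≤n)
  import Data.Nat.Properties as ℕ
  open import Data.Fin as Fin using (Fin; toℕ)
  open import Data.Fin.Properties using (toℕ<n; any?)
  open import Data.Product using (_,_; proj₁; proj₂)
  open import Data.Sum using (_⊎_; inj₁; inj₂)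
  open import Relation.Binary.PropositionalEquality using (_≡_; _≢_; refl; sym; trans; cong; cong₂; subst; subst₂; module ≡-Reasoning)
  open import Relation.Nullary using (¬_; yes; no)
  open import Data.Empty using (⊥-elim)
  open import Function using (_∘_; _⇔_; mk⇔)
  open import Data.Nat.Tactic.RingSolver using (solve-∀)

  balanced-chord : ∀ {n} {G : SG n} (C : Cycle G) → EvenN (negs C) →
    ∀ i j s → toℕ i < toℕ j → NonConsecutive C i j → HasEdge G s (vtx C i) (vtx C j) →
    EvenN (negsIn C (toℕ i) (toℕ j) + bit (isNeg s)) ⊎ EvenN ((negs C ∸ negsIn C (toℕ i) (toℕ j)) + bit (isNeg s)) →
    HasBalancedChord C
  balanced-chord C even i j s i<j nc e (inj₁ even-inside) =
    i , j , s , i<j , nc , e , even-inside , even-complement (negs C) _ _ even (negsIn-≤ (ℕ.<⇒≤ i<j) (ℕ.<⇒≤ (toℕ<n j))) even-inside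
    where open NegativeEdges C
  balanced-chord C even i j s i<j nc e (inj₂ even-outside) =
    i , j , s , i<j , nc , e , even-complement′ (negs C) _ _ even (negsIn-≤ (ℕ.<⇒≤ i<j) (ℕ.<⇒≤ (toℕ<n j))) even-outside , even-outside
    where open NegativeEdges C

  module ChordalOfSimplicial {n} (G : SG (suc n)) (v : Fin (suc n)) (S : Simple G) (ss : SignedSimplicial G v) where
    open SimplicialVertex G v S ss

    -- F inherits balanced chordality: its cycles and chords are those of G
    chordal-delete : BalancedChordal G → BalancedChordal F
    chordal-delete chordal C even long with chordal (lift-cycle C) even long
    ... | i , j , s , i<j , nc , e , bal₁ , bal₂ = i , j , s , i<j , nc , trans (edge-delete s _ _) e , bal₁ , bal₂

    -- A balanced cycle of length ≥ 4 through v = vtx C P has a balanced chord: the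
    -- edge joining the two neighbours Q and R of P on the cycle, which cuts off the
    -- balanced triangle Q P R.
    module ThroughV (C : Cycle G) (even : EvenN (negs C)) (long : 4 ≤ len C) (P : Fin (len C)) (vP : vtx C P ≡ v) where
      open NegativeEdges C

      Q R : Fin (len C)
      Q = proj₁ (predecessor P)
      R = nextPos P

      Q⁺≡P : nextPos Q ≡ P
      Q⁺≡P = proj₂ (predecessor P)

      s : Sign
      s = sgn C Q · sgn C P

      chord-edge : Q ≢ R → HasEdge G s (vtx C Q) (vtx C R)
      chord-edge Q≢R = triangle (sgn C Q) (sgn C P) (Q≢R ∘ inj C)
        (subst (HasEdge G (sgn C Q) (vtx C Q)) (trans (cong (vtx C) Q⁺≡P) vP) (edge C Q))
        (subst (λ x → HasEdge G (sgn C P) x (vtx C R)) vP (edge C P))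

      triangle-balanced : EvenN (negAt Q + negAt P + bit (isNeg s))
      triangle-balanced = ·-balanced (sgn C Q) (sgn C P)

      P≢R : P ≢ R
      P≢R P≡R = nextPos-≢ P (sym P≡R)

      long′ : ∀ {q} → suc q ≡ len C → 3 ≤ q
      long′ e = ℕ.≤-pred (subst (4 ≤_) (sym e) long)

      toℕ≢ : ∀ {x y : Fin (len C)} → toℕ x ≢ toℕ y → x ≢ y
      toℕ≢ ne = ne ∘ cong toℕ

      chord-inside : ∀ q → toℕ Q ≡ q → toℕ P ≡ suc q → toℕ R ≡ suc (suc q) → HasBalancedChord C
      chord-inside q tQ tP tR = balanced-chord C even Q R s Q<R (subst (_≢ R) (sym Q⁺≡P) P≢R , R⁺≢Q) (chord-edge Q≢R)
                                  (inj₁ (subst (λ x → EvenN (x + bit (isNeg s))) (sym window) triangle-balanced))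
        where
        Q<R : toℕ Q < toℕ R
        Q<R = subst₂ _<_ (sym tQ) (sym tR) (ℕ.m≤n⇒m≤1+n (ℕ.n<1+n q))
        Q≢R : Q ≢ R
        Q≢R = toℕ≢ (λ e → ℕ.<⇒≢ Q<R e)
        R⁺≢Q : nextPos R ≢ Q
        R⁺≢Q R⁺≡Q with nextPos-view R
        ... | inner _ e = ℕ.<⇒≢ (ℕ.m≤n⇒m≤1+n (ℕ.m≤n⇒m≤1+n (ℕ.n<1+n q)))
                                (trans (sym tQ) (trans (cong toℕ (sym R⁺≡Q)) (trans e (cong suc tR))))
        ... | last R-last e = ℕ.<⇒≢ (ℕ.≤-pred (ℕ.≤-pred (long′ (trans (cong suc (sym tR)) R-last)))) (sym q≡0)
          where
          q≡0 : q ≡ 0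
          q≡0 = trans (sym tQ) (trans (cong toℕ (sym R⁺≡Q)) e)
        window : negsIn C (toℕ Q) (toℕ R) ≡ negAt Q + negAt P
        window = begin
          negsIn C (toℕ Q) (toℕ R)                                 ≡⟨ cong₂ (negsIn C) tQ tR ⟩
          negsIn C q (suc (suc q))                                 ≡⟨ sym (negsIn-split (ℕ.n≤1+n q) (ℕ.n≤1+n (suc q))) ⟩
          negsIn C q (suc q) + negsIn C (suc q) (suc (suc q))      ≡⟨ cong₂ _+_ (subst (λ x → negsIn C x (suc x) ≡ negAt Q) tQ (negsIn-single Q))
                                                                               (subst (λ x → negsIn C x (suc x) ≡ negAt P) tP (negsIn-single P)) ⟩
          negAt Q + negAt P                                        ∎
          where open ≡-Reasoning

      chord-outside : toℕ R < toℕ Q → nextPos R ≢ Q → negs C ≡ negsIn C (toℕ R) (toℕ Q) + (negAt Q + negAt P) → HasBalancedChord C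
      chord-outside R<Q R⁺≢Q decomposition =
        balanced-chord C even R Q s R<Q (R⁺≢Q , subst (_≢ R) (sym Q⁺≡P) P≢R)
          (trans (edge-sym s _ _) (chord-edge (toℕ≢ (λ e → ℕ.<⇒≢ R<Q (sym e)))))
          (inj₂ (subst (λ x → EvenN (x + bit (isNeg s))) (sym complement) triangle-balanced))
        where
        complement : negs C ∸ negsIn C (toℕ R) (toℕ Q) ≡ negAt Q + negAt P
        complement = trans (cong (_∸ negsIn C (toℕ R) (toℕ Q)) decomposition) (ℕ.m+n∸m≡n (negsIn C (toℕ R) (toℕ Q)) _)

      next-≢ : ∀ x y → suc (toℕ x) < len C → suc (toℕ x) ≢ toℕ y → nextPos x ≢ y
      next-≢ x y x+1<len ne e = ne (trans (sym (nextPos-< x x+1<len)) (cong toℕ e))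

      chord-P-first : suc (toℕ Q) ≡ len C → toℕ (nextPos Q) ≡ 0 → toℕ (nextPos P) ≡ suc (toℕ P) → HasBalancedChord C
      chord-P-first Q-last eQ eP = chord-outside R<Q R⁺≢Q decomposition
        where
        open ≡-Reasoning
        q = toℕ Q
        3≤q : 3 ≤ q
        3≤q = long′ Q-last
        tP : toℕ P ≡ 0
        tP = trans (cong toℕ (sym Q⁺≡P)) eQ
        tR : toℕ R ≡ 1
        tR = trans eP (cong suc tP)
        R<Q : toℕ R < q
        R<Q = subst (_< q) (sym tR) (ℕ.≤-trans (s≤s (s≤s z≤n)) 3≤q)
        R⁺≢Q : nextPos R ≢ Q
        R⁺≢Q = next-≢ R Q (subst (λ r → suc r < len C) (sym tR) (ℕ.≤-trans (ℕ.n≤1+n 3) long))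
                          (λ e → ℕ.<⇒≢ 3≤q (trans (cong suc (sym tR)) e))
        decomposition : negs C ≡ negsIn C (toℕ R) q + (negAt Q + negAt P)
        decomposition = begin
          negs C                                               ≡⟨ sym negsIn-all ⟩
          negsIn C 0 (len C)                                   ≡⟨ sym (negsIn-split z≤n (s≤s z≤n)) ⟩
          negsIn C 0 1 + negsIn C 1 (len C)                    ≡⟨ cong (negsIn C 0 1 +_)
                                                                     (sym (negsIn-split (ℕ.≤-trans (s≤s z≤n) 3≤q) (subst (q ≤_) Q-last (ℕ.n≤1+n q)))) ⟩
          negsIn C 0 1 + (negsIn C 1 q + negsIn C q (len C))   ≡⟨ cong₂ (λ a b → a + (negsIn C 1 q + b))
                                                                     (subst (λ x → negsIn C x (suc x) ≡ negAt P) tP (negsIn-single P))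
                                                                     (subst (λ x → negsIn C q x ≡ negAt Q) Q-last (negsIn-single Q)) ⟩
          negAt P + (negsIn C 1 q + negAt Q)                   ≡⟨ cong (λ r → negAt P + (negsIn C r q + negAt Q)) (sym tR) ⟩
          negAt P + (negsIn C (toℕ R) q + negAt Q)             ≡⟨ rotate (negAt P) (negsIn C (toℕ R) q) (negAt Q) ⟩
          negsIn C (toℕ R) q + (negAt Q + negAt P)             ∎
          where
          rotate : ∀ a b c → a + (b + c) ≡ b + (c + a)
          rotate = solve-∀

      chord-P-last : toℕ (nextPos Q) ≡ suc (toℕ Q) → suc (toℕ P) ≡ len C → toℕ (nextPos P) ≡ 0 → HasBalancedChord C
      chord-P-last eQ P-last eP = chord-outside R<Q R⁺≢Q decomposition
        where
        open ≡-Reasoning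
        q = toℕ Q
        tP : toℕ P ≡ suc q
        tP = trans (cong toℕ (sym Q⁺≡P)) eQ
        2≤q : 2 ≤ q
        2≤q = ℕ.≤-pred (long′ (trans (cong suc (sym tP)) P-last))
        R<Q : toℕ R < q
        R<Q = subst (_< q) (sym eP) (ℕ.≤-trans (s≤s z≤n) 2≤q)
        R⁺≢Q : nextPos R ≢ Q
        R⁺≢Q = next-≢ R Q (subst (λ r → suc r < len C) (sym eP) (s≤s (s≤s z≤n)))
                          (λ e → ℕ.<⇒≢ 2≤q (trans (cong suc (sym eP)) e))
        decomposition : negs C ≡ negsIn C (toℕ R) q + (negAt Q + negAt P)
        decomposition = begin
          negs C                                                    ≡⟨ sym negsIn-all ⟩
          negsIn C 0 (len C)                                        ≡⟨ sym (negsIn-split z≤n (ℕ.<⇒≤ (toℕ<n Q))) ⟩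
          negsIn C 0 q + negsIn C q (len C)                         ≡⟨ cong (negsIn C 0 q +_)
                                                                         (sym (negsIn-split (ℕ.n≤1+n q) (ℕ.<⇒≤ (subst (_< len C) tP (toℕ<n P))))) ⟩
          negsIn C 0 q + (negsIn C q (suc q) + negsIn C (suc q) (len C))
                                                                    ≡⟨ cong₂ (λ a b → negsIn C 0 q + (a + b)) (negsIn-single Q)
                                                                         (subst₂ (λ x y → negsIn C x y ≡ negAt P) tP P-last (negsIn-single P)) ⟩
          negsIn C 0 q + (negAt Q + negAt P)                        ≡⟨ cong (λ r → negsIn C r q + (negAt Q + negAt P)) (sym eP) ⟩
          negsIn C (toℕ R) q + (negAt Q + negAt P)                  ∎

      chord : HasBalancedChord C
      chord with nextPos-view Q | nextPos-view P
      ... | inner _ eQ | inner _ eP = chord-inside (toℕ Q) refl tP (trans eP (cong suc tP))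
        where
        tP : toℕ P ≡ suc (toℕ Q)
        tP = trans (cong toℕ (sym Q⁺≡P)) eQ
      ... | last Q-last eQ | inner _ eP = chord-P-first Q-last eQ eP
      ... | inner _ eQ | last P-last eP = chord-P-last eQ P-last eP
      ... | last _ eQ | last P-last _ = ⊥-elim (4≰1 (subst (4 ≤_) (sym 1≡len) long))
        where
        1≡len : 1 ≡ len C
        1≡len = trans (cong suc (sym (trans (cong toℕ (sym Q⁺≡P)) eQ))) P-last
        4≰1 : ¬ 4 ≤ 1
        4≰1 (s≤s ())

    -- G is balanced chordal when F is: cycles avoiding v are cycles of F
    chordal-extend : BalancedChordal F → BalancedChordal G
    chordal-extend chordal C even long with any? (λ P → vtx C P Fin.≟ v)
    ... | yes (P , vP) = ThroughV.chord C even long P vP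
    ... | no avoids with chordal (AvoidingV.lower-cycle C (λ i e → avoids (i , sym e))) even long
    ...   | i , j , s , i<j , nc , e , bal₁ , bal₂ =
      i , j , s , i<j , nc , subst₂ (HasEdge G s) (lowered-vertex i) (lowered-vertex j) (trans (sym (edge-delete s _ _)) e) , bal₁ , bal₂
      where open AvoidingV C (λ i e → avoids (i , sym e))

    chordal⇔ : BalancedChordal G ⇔ BalancedChordal F
    chordal⇔ = mk⇔ chordal-delete chordal-extend

module Rank where

  open import Defs
  open FiniteSums
  open Parity using (bit)
  open Walks using (least-witness)
  open SimplicialVertices
  open CycleSums using (module NegativeEdges)
  open import Data.Bool using (true)
  open import Data.Nat as ℕ using (ℕ; zero; suc; _+_; _∸_; _≤_)
  import Data.Nat.Properties as ℕ
  open import Data.Fin as Fin using (Fin; punchIn; punchOut)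
  open import Data.Fin.Properties using (punchIn-punchOut; punchOut-punchIn; punchInᵢ≢i; any?; ≤-antisym)
  open import Data.List using (List; length)
  open import Data.List.Relation.Unary.Unique.Propositional using (Unique)
  open import Data.List.Membership.Propositional using (_∈_)
  open import Data.Product using (_×_; _,_; proj₁; proj₂; ∃-syntax)
  open import Data.Sum using (_⊎_; inj₁; inj₂)
  open import Relation.Binary.PropositionalEquality using (_≡_; _≢_; refl; sym; trans; cong; cong₂; subst; subst₂; module ≡-Reasoning)
  open import Relation.Nullary using (yes; no; Dec)
  open import Relation.Binary.Construct.Closure.ReflexiveTransitive using (ε; _◅_; _◅◅_)
  open import Data.Empty using (⊥-elim; ⊥)
  open import Function using (_∘_; _⇔_; Equivalence)
  open import Data.Nat.Tactic.RingSolver using (solve-∀)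

  module RankOfSimplicial {n} (G : SG (suc n)) (v : Fin (suc n)) (S : Simple G) (ss : SignedSimplicial G v) where
    open Simple S
    open SignedSimplicial ss
    open SimplicialVertex G v S ss

    lift-any-cycle : AnyCycle F → AnyCycle G
    lift-any-cycle (cyc1 u l)     = cyc1 (punchIn v u) l
    lift-any-cycle (cyc2 u w p q) = cyc2 (punchIn v u) (punchIn v w) p q
    lift-any-cycle (cycL C)       = cycL (lift-cycle C)

    lift-on : ∀ C {x} → OnCycle C x → OnCycle (lift-any-cycle C) (punchIn v x)
    lift-on (cyc1 u l)     e        = cong (punchIn v) e
    lift-on (cyc2 u w p q) (inj₁ e) = inj₁ (cong (punchIn v) e)
    lift-on (cyc2 u w p q) (inj₂ e) = inj₂ (cong (punchIn v) e)
    lift-on (cycL C)       (i , e)  = i , cong (punchIn v) e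

    lift-balanced : ∀ C → BalancedCycle (lift-any-cycle C) → BalancedCycle C
    lift-balanced (cyc1 u l)     b = b
    lift-balanced (cyc2 u w p q) b = b
    lift-balanced (cycL C)       b = b

    balanced-restrict : ∀ r r′ → BalancedComp G r → Reach G r (punchIn v r′) → BalancedComp F r′
    balanced-restrict r r′ balanced r→r′ C (x , on , r′→x) =
      lift-balanced C (balanced (lift-any-cycle C) (punchIn v x , lift-on C on , r→r′ ◅◅ lift-walk r′→x))

    same-sign-or-digon : ∀ a b {x y} → HasEdge G a x y → HasEdge G b x y → a ≡ b ⊎ (pos G x y ≡ true × neg G x y ≡ true)
    same-sign-or-digon ⊕ ⊕ _ _ = inj₁ refl
    same-sign-or-digon ⊖ ⊖ _ _ = inj₁ refl
    same-sign-or-digon ⊕ ⊖ p q = inj₂ (p , q)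
    same-sign-or-digon ⊖ ⊕ q p = inj₂ (p , q)

    module FromBalancedF (r′ : Fin n) (balanced : BalancedComp F r′) where
      u = punchIn v r′

      v≢u : v ≢ u
      v≢u = punchInᵢ≢i v r′ ∘ sym

      lower-from-u : ∀ y (v≢y : v ≢ y) → Reach G u y → Reach F r′ (punchOut v≢y)
      lower-from-u y v≢y p = subst (λ z → Reach F z (punchOut v≢y)) (punchOut-punchIn v) (lower-walk u y v≢u v≢y p)

      -- no loop is reachable from u (a loop at v forces one at its last neighbour on the walk)
      no-loop-off-v : ∀ y (v≢y : v ≢ y) → Reach G u y → loop G y ≡ true → ⊥
      no-loop-off-v y v≢y p l = balanced (cyc1 (punchOut v≢y) (trans (cong (loop G) (punchIn-punchOut v≢y)) l))
                                         (punchOut v≢y , refl , lower-from-u y v≢y p)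

      no-loop : ∀ y → Reach G u y → loop G y ≡ true → ⊥
      no-loop y p l with v Fin.≟ y
      ... | no v≢y = no-loop-off-v y v≢y p l
      ... | yes refl with WG.last-step p (v≢u ∘ sym)
      ...   | w , u→w , w~v = no-loop-off-v w (Adj⇒≢ w~v ∘ sym) u→w (condC w (inj₁ (w~v , l)))

      no-digon : ∀ y₁ y₂ → Reach G u y₁ → pos G y₁ y₂ ≡ true → neg G y₁ y₂ ≡ true → ⊥
      no-digon y₁ y₂ p e₁ e₂ with v Fin.≟ y₁ | v Fin.≟ y₂
      ... | yes refl | _        = no-loop y₂ (p ◅◅ (inj₁ e₁ ◅ ε)) (condC y₂ (inj₂ (trans (pos-sym y₂ v) e₁ , trans (neg-sym y₂ v) e₂)))
      ... | no _     | yes refl = no-loop y₁ p (condC y₁ (inj₂ (e₁ , e₂)))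
      ... | no v≢y₁  | no v≢y₂  =
        balanced (cyc2 (punchOut v≢y₁) (punchOut v≢y₂)
                       (trans (cong₂ (pos G) (punchIn-punchOut v≢y₁) (punchIn-punchOut v≢y₂)) e₁)
                       (trans (cong₂ (neg G) (punchIn-punchOut v≢y₁) (punchIn-punchOut v≢y₂)) e₂))
                 (punchOut v≢y₁ , inj₁ refl , lower-from-u y₁ v≢y₁ p)

      -- a triangle Q P R through v = vtx C P is balanced: otherwise Q and R are joined
      -- by edges of both signs, the product sign given by `triangle` and the sign of R Q
      triangle-balanced : (C : Cycle G) → ∀ i → Reach G u (vtx C i) →
        ∀ Q P R → nextPos Q ≡ P → nextPos P ≡ R → nextPos R ≡ Q → Q ≢ R → vtx C P ≡ v →
        EvenN (bit (isNeg (sgn C Q)) + bit (isNeg (sgn C P)) + bit (isNeg (sgn C R)))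
      triangle-balanced C i p Q P R QP PR RQ Q≢R vP
        with same-sign-or-digon (sgn C Q · sgn C P) (sgn C R)
               (triangle (sgn C Q) (sgn C P) (Q≢R ∘ inj C)
                 (subst (HasEdge G (sgn C Q) (vtx C Q)) (trans (cong (vtx C) QP) vP) (edge C Q))
                 (subst₂ (HasEdge G (sgn C P)) vP (cong (vtx C) PR) (edge C P)))
               (trans (edge-sym (sgn C R) _ _) (subst (HasEdge G (sgn C R) (vtx C R) ∘ vtx C) RQ (edge C R)))
      ... | inj₁ same      = subst (λ s → EvenN (bit (isNeg (sgn C Q)) + bit (isNeg (sgn C P)) + bit (isNeg s))) same
                                   (·-balanced (sgn C Q) (sgn C P))
      ... | inj₂ (e₁ , e₂) = ⊥-elim (no-digon (vtx C Q) (vtx C R) (p ◅◅ WG.cycle-connected C i Q) e₁ e₂)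

      three-cycle-balanced : ∀ (C : Cycle G) → m C ≡ 0 → ∀ i → Reach G u (vtx C i) → ∀ P → vtx C P ≡ v → EvenN (negs C)
      three-cycle-balanced record { m = suc _ } ()
      three-cycle-balanced C@record { m = zero } refl i p P vP =
        subst EvenN (sym (NegativeEdges.negs-sum C)) (by-position P vP)
        where
        b : Fin 3 → ℕ
        b x = bit (isNeg (sgn C x))
        p₀ p₁ p₂ : Fin 3
        p₀ = Fin.zero
        p₁ = Fin.suc Fin.zero
        p₂ = Fin.suc (Fin.suc Fin.zero)
        rotate₀ : ∀ a b c → c + a + b ≡ a + (b + (c + 0))
        rotate₀ = solve-∀
        rotate₁ : ∀ a b c → a + b + c ≡ a + (b + (c + 0))
        rotate₁ = solve-∀
        rotate₂ : ∀ a b c → b + c + a ≡ a + (b + (c + 0))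
        rotate₂ = solve-∀
        by-position : ∀ P → vtx C P ≡ v → EvenN (b p₀ + (b p₁ + (b p₂ + 0)))
        by-position Fin.zero vP =
          subst EvenN (rotate₀ (b p₀) (b p₁) (b p₂)) (triangle-balanced C i p p₂ p₀ p₁ refl refl refl (λ ()) vP)
        by-position (Fin.suc Fin.zero) vP =
          subst EvenN (rotate₁ (b p₀) (b p₁) (b p₂)) (triangle-balanced C i p p₀ p₁ p₂ refl refl refl (λ ()) vP)
        by-position (Fin.suc (Fin.suc Fin.zero)) vP =
          subst EvenN (rotate₂ (b p₀) (b p₁) (b p₂)) (triangle-balanced C i p p₁ p₂ p₀ refl refl refl (λ ()) vP)

      cycle-balanced : ∀ (C : Cycle G) i → Reach G u (vtx C i) → EvenN (negs C)
      cycle-balanced C i p with any? (λ P → vtx C P Fin.≟ v)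
      ... | no avoids = balanced (cycL lower-cycle) (lowered i , (i , refl) , lower-from-u (vtx C i) (avoids′ i) p)
        where
        avoids′ : ∀ i → v ≢ vtx C i
        avoids′ i e = avoids (i , sym e)
        open AvoidingV C avoids′
      cycle-balanced record { m = suc M ; vtx = vt ; inj = vt-inj ; sgn = sg ; edge = ed } i p | yes (P , vP) =
        parity (balanced (cycL C′) (_ , (Fin.zero , refl) , lower-from-u _ (v≢vt-at Fin.zero) (p ◅◅ WG.cycle-connected C i (at Fin.zero))))
        where open Shortcut M vt vt-inj sg ed P vP
      cycle-balanced C@record { m = zero } i p | yes (P , vP) = three-cycle-balanced C refl i p P vP

    balanced-extend : ∀ r′ r → BalancedComp F r′ → Reach G (punchIn v r′) r → BalancedComp G r
    balanced-extend r′ r balanced r′→r (cyc1 w l) (x , refl , r→x) =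
      ⊥-elim (FromBalancedF.no-loop r′ balanced w (r′→r ◅◅ r→x) l)
    balanced-extend r′ r balanced r′→r (cyc2 w₁ w₂ e₁ e₂) (x , inj₁ refl , r→x) =
      ⊥-elim (FromBalancedF.no-digon r′ balanced w₁ w₂ (r′→r ◅◅ r→x) e₁ e₂)
    balanced-extend r′ r balanced r′→r (cyc2 w₁ w₂ e₁ e₂) (x , inj₂ refl , r→x) =
      ⊥-elim (FromBalancedF.no-digon r′ balanced w₁ w₂ (r′→r ◅◅ r→x ◅◅ (inj₁ (trans (pos-sym w₂ w₁) e₁) ◅ ε)) e₁ e₂)
    balanced-extend r′ r balanced r′→r (cycL C) (x , (i , refl) , r→x) =
      FromBalancedF.cycle-balanced r′ balanced C i (r′→r ◅◅ r→x)

    -- Double counting: each balanced component of G contains exactly one balanced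
    -- component of F, and each balanced component of F lies in exactly one of G.
    module Matching (has-loop-or-neighbour : loop G v ≡ true ⊎ ∃[ w ] Adj G v w)
                    (rs : List (Fin (suc n))) (rs-unique : Unique rs) (rs-reps : ∀ r → (r ∈ rs) ⇔ (IsRep G r × BalancedComp G r))
                    (rs′ : List (Fin n)) (rs′-unique : Unique rs′) (rs′-reps : ∀ r → (r ∈ rs′) ⇔ (IsRep F r × BalancedComp F r)) where
      open Equivalence

      meets? : ∀ r r′ → Dec (Reach G r (punchIn v r′))
      meets? r r′ = WG.Reach? r (punchIn v r′)

      -- a balanced component of G contains a vertex other than v (v has a loop or a neighbour)
      meets-F : ∀ r → BalancedComp G r → ∃[ u′ ] Reach G r (punchIn v u′)
      meets-F r balanced with v Fin.≟ r
      ... | no v≢r = punchOut v≢r , subst (Reach G r) (sym (punchIn-punchOut v≢r)) ε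
      ... | yes refl = from-v has-loop-or-neighbour
        where
        from-v : (loop G v ≡ true ⊎ ∃[ w ] Adj G v w) → ∃[ u′ ] Reach G v (punchIn v u′)
        from-v (inj₁ l)       = ⊥-elim (balanced (cyc1 v l) (v , refl , ε))
        from-v (inj₂ (w , a)) = punchOut (Adj⇒≢ a) , subst (Reach G v) (sym (punchIn-punchOut (Adj⇒≢ a))) (a ◅ ε)

      one-in-F : ∀ r → r ∈ rs → Σ (ind ∘ meets? r) rs′ ≡ 1
      one-in-F r r∈ with meets-F r (proj₂ (to (rs-reps r) r∈))
      ... | u′ , r→u′ with least-witness n (Reach F u′) (WF.Reach? u′) u′ ε
      ...   | r₀ , u′→r₀ , least =
        Count.exactly-one Fin._≟_ (meets? r) rs′ rs′-unique r₀ r₀∈ r→r₀ unique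
        where
        r→r₀ : Reach G r (punchIn v r₀)
        r→r₀ = r→u′ ◅◅ lift-walk u′→r₀
        r₀∈ : r₀ ∈ rs′
        r₀∈ = from (rs′-reps r₀) ((λ z r₀→z → least z (u′→r₀ ◅◅ r₀→z))
                                 , balanced-restrict r r₀ (proj₂ (to (rs-reps r) r∈)) r→r₀)
        unique : ∀ y → y ∈ rs′ → Reach G r (punchIn v y) → y ≡ r₀
        unique y y∈ r→y = ≤-antisym (proj₁ (to (rs′-reps y) y∈) r₀ (WF.Reach-sym r₀→y)) (least y (u′→r₀ ◅◅ r₀→y))
          where
          r₀→y : Reach F r₀ y
          r₀→y = lower-walk′ r₀ y (WG.Reach-sym r→r₀ ◅◅ r→y)

      one-in-G : ∀ r′ → r′ ∈ rs′ → Σ (λ r → ind (meets? r r′)) rs ≡ 1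
      one-in-G r′ r′∈ with least-witness (suc n) (Reach G (punchIn v r′)) (WG.Reach? (punchIn v r′)) (punchIn v r′) ε
      ... | r₀ , r′→r₀ , least = Count.exactly-one Fin._≟_ (λ r → meets? r r′) rs rs-unique r₀ r₀∈ (WG.Reach-sym r′→r₀) unique
        where
        r₀∈ : r₀ ∈ rs
        r₀∈ = from (rs-reps r₀) ((λ z r₀→z → least z (r′→r₀ ◅◅ r₀→z))
                                , balanced-extend r′ r₀ (proj₂ (to (rs′-reps r′) r′∈)) r′→r₀)
        unique : ∀ y → y ∈ rs → Reach G y (punchIn v r′) → y ≡ r₀
        unique y y∈ y→r′ = ≤-antisym (proj₁ (to (rs-reps y) y∈) r₀ (y→r′ ◅◅ r′→r₀)) (least y (WG.Reach-sym y→r′))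

      same-count : length rs ≡ length rs′
      same-count = begin
        length rs                                       ≡⟨ sym (Σ-one rs) ⟩
        Σ (λ _ → 1) rs                                  ≡⟨ Σ-cong-∈ rs (λ r r∈ → sym (one-in-F r r∈)) ⟩
        Σ (λ r → Σ (ind ∘ meets? r) rs′) rs             ≡⟨ Σ-swap (λ r r′ → ind (meets? r r′)) rs rs′ ⟩
        Σ (λ r′ → Σ (λ r → ind (meets? r r′)) rs) rs′   ≡⟨ Σ-cong-∈ rs′ one-in-G ⟩
        Σ (λ _ → 1) rs′                                 ≡⟨ Σ-one rs′ ⟩
        length rs′                                      ∎
        where open ≡-Reasoning

    rank : (loop G v ≡ true ⊎ ∃[ w ] Adj G v w) → ∀ r r′ → HasRank G r → HasRank F r′ → r ≡ r′ + 1
    rank has-loop-or-neighbour r r′ (b , (rs , rs-len , rs-unique , rs-reps) , r≡) (b′ , (rs′ , rs′-len , rs′-unique , rs′-reps) , r′≡) =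
      begin
        r                ≡⟨ r≡ ⟩
        suc n ∸ b        ≡⟨ cong (suc n ∸_) b≡b′ ⟩
        suc n ∸ b′       ≡⟨ ℕ.+-∸-assoc 1 b′≤n ⟩
        suc (n ∸ b′)     ≡⟨ ℕ.+-comm 1 (n ∸ b′) ⟩
        n ∸ b′ + 1       ≡⟨ cong (_+ 1) (sym r′≡) ⟩
        r′ + 1           ∎
      where
      open ≡-Reasoning
      b≡b′ : b ≡ b′
      b≡b′ = trans (sym rs-len) (trans (Matching.same-count has-loop-or-neighbour rs rs-unique rs-reps rs′ rs′-unique rs′-reps) rs′-len)
      b′≤n : b′ ≤ n
      b′≤n = subst (_≤ n) rs′-len (Unique-length-≤ n rs′ rs′-unique)

open import Defs
open import Data.Nat using (ℕ; suc; _+_; _*_; _≤_)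
open import Data.Integer using (+_; _-_) renaming (_*_ to _*ℤ_)
open import Data.Fin using (Fin)
open import Data.Product using (_×_; ∃-syntax)
open import Data.Sum using (_⊎_)
open import Data.Bool using (true)
open import Function using (_⇔_)
open import Relation.Binary.PropositionalEquality using (_≡_)
open import Data.Product using (_,_)

proposition4p17 : ∀ {n} (G : SG (suc n)) (v : Fin (suc n)) → Simple G → SignedSimplicial G v →
    (∀ (w : Fin (suc n)) (s : Sign) → HasEdge G s v w → contract G s v w ≈G delete G v)
    × ((loop G v ≡ true ⊎ ∃[ w ] Adj G v w) →
       ∀ r r′ → HasRank G r → HasRank (delete G v) r′ → r ≡ r′ + 1)
    × (∀ k → 1 ≤ k →
       + numColorings G k ≡ (+ (2 * k + 1) - + degree G v) *ℤ + numColorings (delete G v) k)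
    × (BalancedChordal G ⇔ BalancedChordal (delete G v))
-- The four parts; the colour count of part (3) holds for every k.
proposition4p17 G v S ss =
    contraction
  , rank
  , (λ k _ → chromatic-recursion k)
  , chordal⇔
  where
  open Contraction.ContractionOfSimplicial G v S ss using (contraction)
  open Rank.RankOfSimplicial G v S ss using (rank)
  open Colorings.ColoringsOfSimplicial G v S ss using (chromatic-recursion)
  open BalancedChordality.ChordalOfSimplicial G v S ss using (chordal⇔)
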